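{- For all integers $n,k\ge 0$, $T_n^k(x)=C_n^k(x)$.
   Context: Alternative tableaux: an alternative tableau of rectangular shape of size $n\times k$ is a rectangle of cells with $n$ rows and $k$ columns, each cell either empty or containing a left arrow $\leftarrow$ or a down arrow $\downarrow$, such that every cell pointed to by an arrow is empty (i.e. all cells strictly to the left of a $\leftarrow$ in its row, and all cells strictly below a $\downarrow$ in its column, are empty). Let $\mathcal{T}_n^k$ be the set of these. Weight: for $\lambda\in\mathcal{T}_n^k$ let $s\ge0$ be maximal such that each of the top $s$ rows contains a left arrow; $w(\lambda)$ is the number of left arrows in these top $s$ rows such that every left arrow in the rows above it (within the top $s$ rows) lies in a column strictly to its right. Define $T_n^k(x)=\sum_{\lambda\in\mathcal{T}_n^k}x^{w(\lambda)}$ for $n,k>0$ and $T_n^0(x)=T_0^k(x)=1$. Callan polynomial: for $n,k\ge0$ let $N=\{1,\dots,n\}\cup\{*\}$, $K=\{1,\dots,k\}\cup\{*'\}$. A Callan sequence of size $n\times k$ consists of $r\ge0$, a set partition of $N$ into nonempty blocks $R_1,\dots,R_r,R^*$ with $*\in R^*$ and of $K$ into nonempty blocks $B_1,\dots,B_r,B^*$ with $*'\in B^*$, arranged as the ordered list of ordinary pairs $(B_1;R_1)\cdots(B_r;R_r)$ (order matters) plus the extra pair $(B^*;R^*)$. A barred Callan sequence additionally has one bar in one of the $r+1$ gaps before, between, or after the ordinary pairs; $\mathrm{BC}_n^k$ is their set. For a word of distinct letters from a totally ordered set let $w$ be its number of left-to-right minima minus one. For $\alpha\in\mathrm{BC}_n^k$,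 list from left to right the blue blocks $B_1,\dots,B_r$ and the bar as they appear (extra pair ignored), with the bar smaller than every blue block and blue blocks compared by their least elements; $w(\alpha)$ is $w$ of this word. $C_n^k(x)=\sum_{\alpha\in\mathrm{BC}_n^k}x^{w(\alpha)}$ for $n,k>0$, and $C_n^0(x)=C_0^k(x)=1$. -}

module Defs where

open import Data.Nat using (ℕ; zero; suc; _∸_; _<ᵇ_; _≡ᵇ_; _⊓_)
open import Data.Bool using (Bool; true; false; _∧_; _∨_; not; if_then_else_)
open import Data.Fin using (Fin; toℕ)
open import Data.List using (List; []; _∷_; [_]; _++_; map; concatMap; allFin; upTo; take; drop; foldr)
open import Data.Bool.ListAction using (all; any)
open import Data.Nat.ListAction using (sum)
open import Data.Vec using (Vec; lookup; toList) renaming ([] to []ᵛ; _∷_ to _∷ᵛ_)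

count : {A : Set} → (A → Bool) → List A → ℕ
count p [] = 0
count p (x ∷ xs) = if p x then suc (count p xs) else count p xs

vecs : {A : Set} → List A → (n : ℕ) → List (Vec A n)
vecs l zero = [ []ᵛ ]
vecs l (suc n) = concatMap (λ x → map (x ∷ᵛ_) (vecs l n)) l

-- the constant polynomial 1, as a coefficient function
one : ℕ → ℕ
one m = if m ≡ᵇ 0 then 1 else 0

-- Alternative tableaux of rectangular shape n × k

data Cell : Set where
  empty leftArrow downArrow : Cell

allCells : List Cell
allCells = empty ∷ leftArrow ∷ downArrow ∷ []

isEmpty : Cell → Bool
isEmpty empty = true
isEmpty _ = false

isLeft : Cell → Bool
isLeft leftArrow = true
isLeft _ = false

-- A filling: row i (i = 0 is the TOP row), column j (j = 0 is the leftmost column).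
Filling : ℕ → ℕ → Set
Filling n k = Vec (Vec Cell k) n

cell : {n k : ℕ} → Filling n k → Fin n → Fin k → Cell
cell t i j = lookup (lookup t i) j

-- the condition at cell (i , j): every cell pointed to by its arrow is empty
cellOK : {n k : ℕ} → Filling n k → Fin n → Fin k → Cell → Bool
cellOK {n} {k} t i j empty = true
cellOK {n} {k} t i j leftArrow =
  all (λ j' → not (toℕ j' <ᵇ toℕ j) ∨ isEmpty (cell t i j')) (allFin k)
cellOK {n} {k} t i j downArrow =
  all (λ i' → not (toℕ i <ᵇ toℕ i') ∨ isEmpty (cell t i' j)) (allFin n)

isTableau : {n k : ℕ} → Filling n k → Bool
isTableau {n} {k} t = all (λ i → all (λ j → cellOK t i j (cell t i j)) (allFin k)) (allFin n)

topS : {n k : ℕ} → Filling n k → ℕ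
topS []ᵛ = 0
topS (r ∷ᵛ rs) = if any isLeft (toList r) then suc (topS rs) else 0

counted : {n k : ℕ} → Filling n k → Fin n → Fin k → Bool
counted {n} {k} t i j =
  (toℕ i <ᵇ topS t) ∧ isLeft (cell t i j) ∧
  all (λ i' → not (toℕ i' <ᵇ toℕ i) ∨
         all (λ j' → not (isLeft (cell t i' j')) ∨ (toℕ j <ᵇ toℕ j')) (allFin k))
      (allFin n)

weightT : {n k : ℕ} → Filling n k → ℕ
weightT {n} {k} t =
  sum (map (λ i → count (λ j → counted t i j) (allFin k)) (allFin n))

-- coefficient of x^m in T_n^k(x)
T : ℕ → ℕ → ℕ → ℕ
T zero k m = one m
T (suc n) zero m = one m
T (suc n) (suc k) m =
  count (λ t → isTableau t ∧ (weightT t ≡ᵇ m)) (vecs (vecs allCells (suc k)) (suc n))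

-- Barred Callan sequences of size n × k
--
-- A barred Callan sequence with r ordinary pairs is encoded by
--   f   : Vec (Fin (suc r)) n  -- f[a] = i < r : red element a+1 lies in R_{i+1};
--                               -- f[a] = r     : it lies in R^*
--   g   : Vec (Fin (suc r)) k  -- same for the blue elements and B_1..B_r, B^*
--   bar : Fin (suc r)          -- bar = p : the bar sits right before pair p+1
--                               -- (p = r: after the last ordinary pair)
-- with f and g hitting every ordinary index i < r (blocks nonempty).

surj : {r m : ℕ} → Vec (Fin (suc r)) m → Bool
surj {r} {m} f = all (λ i → any (λ a → toℕ (lookup f a) ≡ᵇ i) (allFin m)) (upTo r)

-- least element (as a number in 1..k) of the blue block B_{i+1}
minBlock : {r k : ℕ} → Vec (Fin (suc r)) k → ℕ → ℕ
minBlock {r} {k} g i =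
  foldr (λ j acc → if toℕ (lookup g j) ≡ᵇ i then suc (toℕ j) ⊓ acc else acc) (suc k) (allFin k)

lrMinFrom : ℕ → List ℕ → ℕ
lrMinFrom m [] = 0
lrMinFrom m (x ∷ xs) = if x <ᵇ m then suc (lrMinFrom x xs) else lrMinFrom m xs

lrMin : List ℕ → ℕ
lrMin [] = 0
lrMin (x ∷ xs) = suc (lrMinFrom x xs)

-- the word of blue blocks and bar: the bar is encoded by 0, the block B_i
-- by its least element (≥ 1), so the bar is smaller than every block
weightC : {r n k : ℕ} → Vec (Fin (suc r)) n → Vec (Fin (suc r)) k → Fin (suc r) → ℕ
weightC {r} f g bar =
  let blocks = map (minBlock g) (upTo r)
      p = toℕ bar
  in lrMin (take p blocks ++ (0 ∷ drop p blocks)) ∸ 1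

CallanR : ℕ → ℕ → ℕ → ℕ → ℕ
CallanR n k m r =
  sum (map (λ f → sum (map (λ g →
         count (λ bar → surj f ∧ surj g ∧ (weightC f g bar ≡ᵇ m)) (allFin (suc r)))
       (vecs (allFin (suc r)) k)))
     (vecs (allFin (suc r)) n))

-- coefficient of x^m in C_n^k(x); r ranges over 0..n (r ≤ n is forced
-- since R_1..R_r are nonempty disjoint subsets of {1..n})
C : ℕ → ℕ → ℕ → ℕ
C zero k m = one m
C (suc n) zero m = one m
C (suc n) (suc k) m = sum (map (CallanR (suc n) (suc k) m) (upTo (suc (suc n))))

module Submission where

-- Both sides equal Φ n k = Σ_{r ≤ n} F n r · G k r, where F n r counts the
-- red labellings with r nonempty ordinary blocks and G k r the weighted blue
-- sides with a bar; F and G are determined by the recursions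
--   F (n+1) (r+1) = (r+2) F n (r+1) + (r+1) F n r,
--   G (k+1) (r+1) = (r+2) G k (r+1) + (r+1) G k r + x G k r.
-- Callan side: the count factors into a red and a blue part, each obeying
-- its recursion when one element is removed (a singleton block is deleted,
-- the other blocks relabelled by punchIn); the blue weight is read off the
-- word of block minima in front of the bar.
-- Tableau side: an n × (k+1) tableau is a valid last column c together with
-- a tableau of k columns having one row per non-left cell of c, the weight
-- growing by one iff c starts with a left arrow.  This is proved by a
-- top-down row induction on a count that remembers the blocked and the still
-- counting columns; counting the columns then turns Φ _ k into Φ _ (k+1).

open import Defs
open import Data.Nat using (ℕ; zero; suc; _+_; _*_; _∸_; _<ᵇ_; _≡ᵇ_; _⊓_; _≤_; _<_; z≤n; s≤s)
open import Data.Nat.Properties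
open import Data.Nat.Tactic.RingSolver using (solve-∀)
open import Data.Bool using (Bool; true; false; _∧_; _∨_; not; if_then_else_)
open import Data.Bool.Properties
  using (∧-assoc; ∧-identityʳ; ∧-zeroʳ; ∧-idem; ∨-identityʳ; ∨-zeroʳ; ∨-assoc; ∨-comm; ∨-distribˡ-∧)
open import Data.Bool.Solver using (module ∨-∧-Solver)
open import Data.Bool.ListAction using (all; any)
open import Data.Nat.ListAction using (sum)
open import Data.Fin using (Fin; toℕ; inject₁; fromℕ; punchIn) renaming (zero to fz; suc to fs)
open import Data.Fin.Properties using (toℕ-fromℕ; toℕ-inject₁; toℕ<n; toℕ≤pred[n])
open import Data.Vec.Properties using (lookup-replicate)
open import Data.List using (List; []; _∷_; _++_; map; concatMap; allFin; upTo; applyUpTo; take; drop; foldr; tabulate; length)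
open import Data.List.Properties using (length-applyUpTo; map-applyUpTo; take-map)
open import Data.Vec using (Vec; lookup; toList; replicate; _∷ʳ_) renaming ([] to []ᵛ; _∷_ to _∷ᵛ_; map to vmap)
open import Data.Unit using (⊤; tt)
open import Function using (_∘_)
open import Relation.Binary.PropositionalEquality using (_≡_; refl; sym; trans; cong; cong₂; subst; module ≡-Reasoning)

⟦_⟧ : Bool → ℕ
⟦ true ⟧ = 1
⟦ false ⟧ = 0

⟦∧⟧ : ∀ a b → ⟦ a ∧ b ⟧ ≡ ⟦ a ⟧ * ⟦ b ⟧
⟦∧⟧ true b = sym (+-identityʳ ⟦ b ⟧)
⟦∧⟧ false b = refl

⟦⟧-guard : (b : Bool) {x y : ℕ} → (b ≡ true → x ≡ y) → ⟦ b ⟧ * x ≡ ⟦ b ⟧ * y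
⟦⟧-guard true e = cong (1 *_) (e refl)
⟦⟧-guard false e = refl

interchange : ∀ a b c d → (a + b) + (c + d) ≡ (a + c) + (b + d)
interchange = solve-∀

module _ where
  open ∨-∧-Solver using (solve; _:*_; _:=_)

  ∧-interchange : ∀ a b c d → (a ∧ b) ∧ (c ∧ d) ≡ (a ∧ c) ∧ (b ∧ d)
  ∧-interchange = solve 4 (λ a b c d → (a :* b) :* (c :* d) := (a :* c) :* (b :* d)) refl

  ∧-pull₅ : ∀ a b l c p → (a ∧ (b ∧ (l ∧ c))) ∧ p ≡ (a ∧ (b ∧ c)) ∧ (l ∧ p)
  ∧-pull₅ = solve 5 (λ a b l c p → (a :* (b :* (l :* c))) :* p := (a :* (b :* c)) :* (l :* p)) refl

  ∧-regroup₆ : ∀ a b c d e f → ((a ∧ b) ∧ c) ∧ ((d ∧ e) ∧ f) ≡ (a ∧ d) ∧ (c ∧ ((e ∧ b) ∧ f))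
  ∧-regroup₆ = solve 6 (λ a b c d e f → ((a :* b) :* c) :* ((d :* e) :* f) := (a :* d) :* (c :* ((e :* b) :* f))) refl

∑ : {A : Set} → List A → (A → ℕ) → ℕ
∑ [] f = 0
∑ (x ∷ xs) f = f x + ∑ xs f

count-as-∑ : {A : Set} (p : A → Bool) (xs : List A) → count p xs ≡ ∑ xs (λ x → ⟦ p x ⟧)
count-as-∑ p [] = refl
count-as-∑ p (x ∷ xs) with p x
... | true = cong suc (count-as-∑ p xs)
... | false = count-as-∑ p xs

sum-map-as-∑ : {A : Set} (f : A → ℕ) (xs : List A) → sum (map f xs) ≡ ∑ xs f
sum-map-as-∑ f [] = refl
sum-map-as-∑ f (x ∷ xs) = cong (f x +_) (sum-map-as-∑ f xs)

∑-cong : {A : Set} {f g : A → ℕ} (xs : List A) → (∀ x → f x ≡ g x) → ∑ xs f ≡ ∑ xs g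
∑-cong [] e = refl
∑-cong (x ∷ xs) e = cong₂ _+_ (e x) (∑-cong xs e)

∑-zero : {A : Set} {f : A → ℕ} (xs : List A) → (∀ x → f x ≡ 0) → ∑ xs f ≡ 0
∑-zero [] e = refl
∑-zero (x ∷ xs) e rewrite e x = ∑-zero xs e

∑-+ : {A : Set} (f g : A → ℕ) (xs : List A) → ∑ xs (λ x → f x + g x) ≡ ∑ xs f + ∑ xs g
∑-+ f g [] = refl
∑-+ f g (x ∷ xs) rewrite ∑-+ f g xs = interchange (f x) (g x) (∑ xs f) (∑ xs g)

∑-*ˡ : {A : Set} (c : ℕ) (f : A → ℕ) (xs : List A) → ∑ xs (λ x → c * f x) ≡ c * ∑ xs f
∑-*ˡ c f [] = sym (*-zeroʳ c)
∑-*ˡ c f (x ∷ xs) rewrite ∑-*ˡ c f xs = sym (*-distribˡ-+ c (f x) (∑ xs f))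

∑-*ʳ : {A : Set} (c : ℕ) (f : A → ℕ) (xs : List A) → ∑ xs (λ x → f x * c) ≡ ∑ xs f * c
∑-*ʳ c f xs = trans (∑-cong xs (λ x → *-comm (f x) c)) (trans (∑-*ˡ c f xs) (*-comm c _))

∑-++ : {A : Set} (f : A → ℕ) (xs ys : List A) → ∑ (xs ++ ys) f ≡ ∑ xs f + ∑ ys f
∑-++ f [] ys = refl
∑-++ f (x ∷ xs) ys rewrite ∑-++ f xs ys = sym (+-assoc (f x) (∑ xs f) (∑ ys f))

∑-map : {A B : Set} (f : B → ℕ) (g : A → B) (xs : List A) → ∑ (map g xs) f ≡ ∑ xs (f ∘ g)
∑-map f g [] = refl
∑-map f g (x ∷ xs) = cong (f (g x) +_) (∑-map f g xs)

∑-concatMap : {A B : Set} (f : B → ℕ) (g : A → List B) (xs : List A) →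
  ∑ (concatMap g xs) f ≡ ∑ xs (λ x → ∑ (g x) f)
∑-concatMap f g [] = refl
∑-concatMap f g (x ∷ xs) = trans (∑-++ f (g x) (concatMap g xs)) (cong (∑ (g x) f +_) (∑-concatMap f g xs))

∑-swap : {A B : Set} (f : A → B → ℕ) (xs : List A) (ys : List B) →
  ∑ xs (λ x → ∑ ys (f x)) ≡ ∑ ys (λ y → ∑ xs (λ x → f x y))
∑-swap f [] ys = sym (∑-zero ys (λ _ → refl))
∑-swap f (x ∷ xs) ys rewrite ∑-swap f xs ys = sym (∑-+ (f x) (λ y → ∑ xs (λ x → f x y)) ys)

∑-vecs-cons : {A : Set} (l : List A) (n : ℕ) (f : Vec A (suc n) → ℕ) →
  ∑ (vecs l (suc n)) f ≡ ∑ l (λ x → ∑ (vecs l n) (λ v → f (x ∷ᵛ v)))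
∑-vecs-cons l n f = trans (∑-concatMap f _ l) (∑-cong l (λ x → ∑-map f _ (vecs l n)))

∑-vecs-snoc : {A : Set} (l : List A) (n : ℕ) (f : Vec A (suc n) → ℕ) →
  ∑ (vecs l (suc n)) f ≡ ∑ (vecs l n) (λ v → ∑ l (λ y → f (v ∷ʳ y)))
∑-vecs-snoc l zero f =
  trans (∑-vecs-cons l 0 f) (trans (∑-cong l (λ x → +-identityʳ _)) (sym (+-identityʳ _)))
∑-vecs-snoc l (suc n) f = begin
    ∑ (vecs l (suc (suc n))) f
  ≡⟨ ∑-vecs-cons l (suc n) f ⟩
    ∑ l (λ x → ∑ (vecs l (suc n)) (λ v → f (x ∷ᵛ v)))
  ≡⟨ ∑-cong l (λ x → ∑-vecs-snoc l n (λ v → f (x ∷ᵛ v))) ⟩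
    ∑ l (λ x → ∑ (vecs l n) (λ v → ∑ l (λ y → f (x ∷ᵛ (v ∷ʳ y)))))
  ≡⟨ sym (∑-vecs-cons l n (λ w → ∑ l (λ y → f (w ∷ʳ y)))) ⟩
    ∑ (vecs l (suc n)) (λ v → ∑ l (λ y → f (v ∷ʳ y)))
  ∎
  where open ≡-Reasoning

∑Fin : (n : ℕ) → (Fin n → ℕ) → ℕ
∑Fin zero f = 0
∑Fin (suc n) f = f fz + ∑Fin n (f ∘ fs)

∀Fin : (n : ℕ) → (Fin n → Bool) → Bool
∀Fin zero p = true
∀Fin (suc n) p = p fz ∧ ∀Fin n (p ∘ fs)

∃Fin : (n : ℕ) → (Fin n → Bool) → Bool
∃Fin zero p = false
∃Fin (suc n) p = p fz ∨ ∃Fin n (p ∘ fs)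

∑-allFin : (n : ℕ) (f : Fin n → ℕ) → ∑ (allFin n) f ≡ ∑Fin n f
∑-allFin n f = go n (λ i → i)
  where
    go : (n : ℕ) (g : Fin n → Fin _) → ∑ (tabulate g) f ≡ ∑Fin n (f ∘ g)
    go zero g = refl
    go (suc n) g = cong (f (g fz) +_) (go n (g ∘ fs))

all-allFin : (n : ℕ) (p : Fin n → Bool) → all p (allFin n) ≡ ∀Fin n p
all-allFin n p = go n (λ i → i)
  where
    go : (n : ℕ) (g : Fin n → Fin _) → all p (tabulate g) ≡ ∀Fin n (p ∘ g)
    go zero g = refl
    go (suc n) g = cong (p (g fz) ∧_) (go n (g ∘ fs))

any-allFin : (n : ℕ) (p : Fin n → Bool) → any p (allFin n) ≡ ∃Fin n p
any-allFin n p = go n (λ i → i)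
  where
    go : (n : ℕ) (g : Fin n → Fin _) → any p (tabulate g) ≡ ∃Fin n (p ∘ g)
    go zero g = refl
    go (suc n) g = cong (p (g fz) ∨_) (go n (g ∘ fs))

count-allFin : (n : ℕ) (p : Fin n → Bool) → count p (allFin n) ≡ ∑Fin n (λ i → ⟦ p i ⟧)
count-allFin n p = trans (count-as-∑ p (allFin n)) (∑-allFin n _)

∑Fin-cong : (n : ℕ) {f g : Fin n → ℕ} → (∀ i → f i ≡ g i) → ∑Fin n f ≡ ∑Fin n g
∑Fin-cong zero e = refl
∑Fin-cong (suc n) e = cong₂ _+_ (e fz) (∑Fin-cong n (e ∘ fs))

∀Fin-cong : (n : ℕ) {p q : Fin n → Bool} → (∀ i → p i ≡ q i) → ∀Fin n p ≡ ∀Fin n q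
∀Fin-cong zero e = refl
∀Fin-cong (suc n) e = cong₂ _∧_ (e fz) (∀Fin-cong n (e ∘ fs))

∑Fin-zero : (n : ℕ) {f : Fin n → ℕ} → (∀ i → f i ≡ 0) → ∑Fin n f ≡ 0
∑Fin-zero zero e = refl
∑Fin-zero (suc n) e rewrite e fz = ∑Fin-zero n (e ∘ fs)

∑Fin-+ : (n : ℕ) (f g : Fin n → ℕ) → ∑Fin n (λ i → f i + g i) ≡ ∑Fin n f + ∑Fin n g
∑Fin-+ zero f g = refl
∑Fin-+ (suc n) f g rewrite ∑Fin-+ n (f ∘ fs) (g ∘ fs) = interchange (f fz) (g fz) _ _

∑Fin-*ˡ : (n c : ℕ) (h : Fin n → ℕ) → ∑Fin n (λ j → c * h j) ≡ c * ∑Fin n h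
∑Fin-*ˡ zero c h = sym (*-zeroʳ c)
∑Fin-*ˡ (suc n) c h rewrite ∑Fin-*ˡ n c (h ∘ fs) = sym (*-distribˡ-+ c (h fz) _)

∑Fin-const : (n c : ℕ) → ∑Fin n (λ _ → c) ≡ n * c
∑Fin-const zero c = refl
∑Fin-const (suc n) c = cong (c +_) (∑Fin-const n c)

∑-∑Fin-swap : {A : Set} (xs : List A) (n : ℕ) (f : A → Fin n → ℕ) →
  ∑ xs (λ x → ∑Fin n (f x)) ≡ ∑Fin n (λ j → ∑ xs (λ x → f x j))
∑-∑Fin-swap xs n f = trans (∑-cong xs (λ x → sym (∑-allFin n (f x))))
                      (trans (∑-swap f xs (allFin n)) (∑-allFin n (λ j → ∑ xs (λ x → f x j))))

∑Fin-last : (k : ℕ) (f : Fin (suc k) → ℕ) → ∑Fin (suc k) f ≡ ∑Fin k (f ∘ inject₁) + f (fromℕ k)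
∑Fin-last zero f = +-comm (f fz) 0
∑Fin-last (suc k) f rewrite ∑Fin-last k (f ∘ fs) = sym (+-assoc (f fz) _ _)

∀Fin-last : (k : ℕ) (p : Fin (suc k) → Bool) → ∀Fin (suc k) p ≡ ∀Fin k (p ∘ inject₁) ∧ p (fromℕ k)
∀Fin-last zero p = ∧-identityʳ (p fz)
∀Fin-last (suc k) p rewrite ∀Fin-last k (p ∘ fs) = sym (∧-assoc (p fz) _ _)

∀Fin-true : (k : ℕ) {p : Fin k → Bool} → (∀ j → p j ≡ true) → ∀Fin k p ≡ true
∀Fin-true zero e = refl
∀Fin-true (suc k) e rewrite e fz = ∀Fin-true k (e ∘ fs)

∀Fin-∧ : (k : ℕ) (p q : Fin k → Bool) → ∀Fin k (λ j → p j ∧ q j) ≡ ∀Fin k p ∧ ∀Fin k q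
∀Fin-∧ zero p q = refl
∀Fin-∧ (suc k) p q rewrite ∀Fin-∧ k (p ∘ fs) (q ∘ fs) = ∧-interchange (p fz) (q fz) _ _

∀Fin-not : (k : ℕ) (p : Fin k → Bool) → ∀Fin k (λ j → not (p j)) ≡ not (∃Fin k p)
∀Fin-not zero p = refl
∀Fin-not (suc k) p rewrite ∀Fin-not k (p ∘ fs) with p fz
... | true = refl
... | false = refl

∑< : ℕ → (ℕ → ℕ) → ℕ
∑< zero h = 0
∑< (suc R) h = h 0 + ∑< R (h ∘ suc)

∀< : ℕ → (ℕ → Bool) → Bool
∀< zero p = true
∀< (suc r) p = p 0 ∧ ∀< r (p ∘ suc)

∑<-cong : (R : ℕ) {f g : ℕ → ℕ} → (∀ r → r < R → f r ≡ g r) → ∑< R f ≡ ∑< R g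
∑<-cong zero e = refl
∑<-cong (suc R) e = cong₂ _+_ (e 0 (s≤s z≤n)) (∑<-cong R (λ r r<R → e (suc r) (s≤s r<R)))

∑<-zero : (R : ℕ) {h : ℕ → ℕ} → (∀ r → h r ≡ 0) → ∑< R h ≡ 0
∑<-zero zero e = refl
∑<-zero (suc R) e rewrite e 0 = ∑<-zero R (e ∘ suc)

∑<-+ : (R : ℕ) (f g : ℕ → ℕ) → ∑< R (λ r → f r + g r) ≡ ∑< R f + ∑< R g
∑<-+ zero f g = refl
∑<-+ (suc R) f g rewrite ∑<-+ R (f ∘ suc) (g ∘ suc) = interchange (f 0) (g 0) _ _

∑<-*ˡ : (R c : ℕ) (h : ℕ → ℕ) → ∑< R (λ r → c * h r) ≡ c * ∑< R h
∑<-*ˡ zero c h = sym (*-zeroʳ c)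
∑<-*ˡ (suc R) c h rewrite ∑<-*ˡ R c (h ∘ suc) = sym (*-distribˡ-+ c (h 0) _)

∑<-const : (R c : ℕ) → ∑< R (λ _ → c) ≡ R * c
∑<-const zero c = refl
∑<-const (suc R) c = cong (c +_) (∑<-const R c)

∑<-extend : (R d : ℕ) (h : ℕ → ℕ) → (∀ i → h (R + i) ≡ 0) → ∑< (R + d) h ≡ ∑< R h
∑<-extend zero zero h e = refl
∑<-extend zero (suc d) h e rewrite e 0 = ∑<-extend zero d (h ∘ suc) (λ i → e (suc i))
∑<-extend (suc R) d h e = cong (h 0 +_) (∑<-extend R d (h ∘ suc) e)

∑-∑<-swap : {A : Set} (xs : List A) (R : ℕ) (f : A → ℕ → ℕ) →
  ∑ xs (λ x → ∑< R (f x)) ≡ ∑< R (λ r → ∑ xs (λ x → f x r))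
∑-∑<-swap xs zero f = ∑-zero xs (λ _ → refl)
∑-∑<-swap xs (suc R) f = trans (∑-+ (λ x → f x 0) (λ x → ∑< R (f x ∘ suc)) xs)
                                (cong (∑ xs (λ x → f x 0) +_) (∑-∑<-swap xs R (λ x → f x ∘ suc)))

∑Fin-toℕ : (n : ℕ) (φ : ℕ → ℕ) → ∑Fin n (φ ∘ toℕ) ≡ ∑< n φ
∑Fin-toℕ zero φ = refl
∑Fin-toℕ (suc n) φ = cong (φ 0 +_) (∑Fin-toℕ n (φ ∘ suc))

∑-applyUpTo : (f : ℕ → ℕ) (N : ℕ) (h : ℕ → ℕ) → ∑ (applyUpTo f N) h ≡ ∑< N (h ∘ f)
∑-applyUpTo f zero h = refl
∑-applyUpTo f (suc N) h = cong (h (f 0) +_) (∑-applyUpTo (f ∘ suc) N h)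

∀<-cong : (r : ℕ) {p q : ℕ → Bool} → (∀ i → i < r → p i ≡ q i) → ∀< r p ≡ ∀< r q
∀<-cong zero e = refl
∀<-cong (suc r) e = cong₂ _∧_ (e 0 (s≤s z≤n)) (∀<-cong r (λ i i<r → e (suc i) (s≤s i<r)))

∀<-true : (r : ℕ) (p : ℕ → Bool) → ∀< r p ≡ true → ∀ i → i < r → p i ≡ true
∀<-true (suc r) p e zero _ with p 0 | e
... | true | _ = refl
∀<-true (suc r) p e (suc i) (s≤s i<r) with p 0 | e
... | true | e' = ∀<-true r (p ∘ suc) e' i i<r

∀<-false : (r j : ℕ) (p : ℕ → Bool) → j < r → p j ≡ false → ∀< r p ≡ false
∀<-false (suc r) zero p _ e rewrite e = refl
∀<-false (suc r) (suc j) p (s≤s j<r) e rewrite ∀<-false r j (p ∘ suc) j<r e = ∧-zeroʳ (p 0)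

all-applyUpTo : (f : ℕ → ℕ) (r : ℕ) (p : ℕ → Bool) → all p (applyUpTo f r) ≡ ∀< r (p ∘ f)
all-applyUpTo f zero p = refl
all-applyUpTo f (suc r) p = cong (p (f 0) ∧_) (all-applyUpTo (f ∘ suc) r p)

applyUpTo-cong : (r : ℕ) {f g : ℕ → ℕ} → (∀ i → i < r → f i ≡ g i) → applyUpTo f r ≡ applyUpTo g r
applyUpTo-cong zero e = refl
applyUpTo-cong (suc r) e = cong₂ _∷_ (e 0 (s≤s z≤n)) (applyUpTo-cong r (λ i i<r → e (suc i) (s≤s i<r)))

-- multiplication of a coefficient sequence by x
shift : (ℕ → ℕ) → ℕ → ℕ
shift P zero = 0
shift P (suc m) = P m

shift-cong : {P Q : ℕ → ℕ} → (∀ m → P m ≡ Q m) → ∀ m → shift P m ≡ shift Q m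
shift-cong e zero = refl
shift-cong e (suc m) = e m

shift-∑< : (R : ℕ) (f : ℕ → ℕ → ℕ) (m : ℕ) →
  shift (λ m' → ∑< R (λ r → f r m')) m ≡ ∑< R (λ r → shift (f r) m)
shift-∑< R f zero = sym (∑<-zero R (λ r → refl))
shift-∑< R f (suc m) = refl

shift-∑ : {A : Set} (xs : List A) (c : A → ℕ) (Q : A → ℕ → ℕ) (m : ℕ) →
  ∑ xs (λ x → c x * shift (Q x) m) ≡ shift (λ m' → ∑ xs (λ x → c x * Q x m')) m
shift-∑ xs c Q zero = ∑-zero xs (λ x → *-zeroʳ (c x))
shift-∑ xs c Q (suc m) = refl

-- The common value Φ n k m = Σ_{r ≤ n} F n r · G k r m

-- F n r: functions {1..n} → {0..r} taking every value i < r
F : ℕ → ℕ → ℕ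
F zero zero = 1
F zero (suc r) = 0
F (suc n) zero = F n 0
F (suc n) (suc r) = suc (suc r) * F n (suc r) + suc r * F n r

-- G k r m: coefficient of x^m in the weighted count of blue sides with r
-- ordinary blocks and a bar
G : ℕ → ℕ → ℕ → ℕ
G zero zero m = one m
G zero (suc r) m = 0
G (suc k) zero m = G k 0 m
G (suc k) (suc r) m = suc (suc r) * G k (suc r) m + suc r * G k r m + shift (G k r) m

Φ : ℕ → ℕ → ℕ → ℕ
Φ n k m = ∑< (suc n) (λ r → F n r * G k r m)

-- more than n nonempty red blocks are impossible
F-vanishes : (n r : ℕ) → F n (suc (n + r)) ≡ 0
F-vanishes zero r = refl
F-vanishes (suc n) r rewrite sym (+-suc n r) | F-vanishes n (suc r) | +-suc n r | F-vanishes n r =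
  cong₂ _+_ (*-zeroʳ (suc (suc (suc (n + r))))) (*-zeroʳ (suc (suc (n + r))))

F-0 : (n : ℕ) → F n 0 ≡ 1
F-0 zero = refl
F-0 (suc n) = F-0 n

G-0 : (k m : ℕ) → G k 0 m ≡ one m
G-0 zero m = refl
G-0 (suc k) m = G-0 k m

≡ᵇ-refl : ∀ a → (a ≡ᵇ a) ≡ true
≡ᵇ-refl zero = refl
≡ᵇ-refl (suc a) = ≡ᵇ-refl a

≡ᵇ-true⇒≡ : (a b : ℕ) → (a ≡ᵇ b) ≡ true → a ≡ b
≡ᵇ-true⇒≡ zero zero e = refl
≡ᵇ-true⇒≡ (suc a) (suc b) e = cong suc (≡ᵇ-true⇒≡ a b e)

>⇒≡ᵇ-false : (r i : ℕ) → i < r → (r ≡ᵇ i) ≡ false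
>⇒≡ᵇ-false (suc r) zero _ = refl
>⇒≡ᵇ-false (suc r) (suc i) (s≤s i<r) = >⇒≡ᵇ-false r i i<r

≤⇒<ᵇ-false : (c M : ℕ) → c ≤ M → (M <ᵇ c) ≡ false
≤⇒<ᵇ-false zero M _ = refl
≤⇒<ᵇ-false (suc c) (suc M) (s≤s c≤M) = ≤⇒<ᵇ-false c M c≤M

<⇒<ᵇ-true : (a M : ℕ) → a < M → (a <ᵇ M) ≡ true
<⇒<ᵇ-true zero (suc M) _ = refl
<⇒<ᵇ-true (suc a) (suc M) (s≤s a<M) = <⇒<ᵇ-true a M a<M

<ᵇ-true-≤-trans : (x c M : ℕ) → (x <ᵇ c) ≡ true → c ≤ M → x ≤ M
<ᵇ-true-≤-trans zero c M _ _ = z≤n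
<ᵇ-true-≤-trans (suc x) (suc c) (suc M) e (s≤s c≤M) = s≤s (<ᵇ-true-≤-trans x c M e c≤M)

hits : {r m : ℕ} → Vec (Fin (suc r)) m → ℕ → Bool
hits []ᵛ i = false
hits (x ∷ᵛ xs) i = (toℕ x ≡ᵇ i) ∨ hits xs i

surj-as-∀< : {r m : ℕ} (f : Vec (Fin (suc r)) m) → surj f ≡ ∀< r (hits f)
surj-as-∀< {r} {m} f = trans (all-applyUpTo (λ x → x) r _) (∀<-cong r (λ i _ → trans (any-allFin m _) (any-hits f i)))
  where
    any-hits : {m : ℕ} (f : Vec (Fin (suc r)) m) (i : ℕ) → ∃Fin m (λ a → toℕ (lookup f a) ≡ᵇ i) ≡ hits f i
    any-hits []ᵛ i = refl
    any-hits (x ∷ᵛ xs) i = cong ((toℕ x ≡ᵇ i) ∨_) (any-hits xs i)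

surj⇒hits : {r m : ℕ} (f : Vec (Fin (suc r)) m) → surj f ≡ true → ∀ i → i < r → hits f i ≡ true
surj⇒hits {r} f e = ∀<-true r (hits f) (trans (sym (surj-as-∀< f)) e)

hits-snoc : {r k : ℕ} (g : Vec (Fin (suc r)) k) (y : Fin (suc r)) (i : ℕ) → hits (g ∷ʳ y) i ≡ hits g i ∨ (toℕ y ≡ᵇ i)
hits-snoc []ᵛ y i = ∨-identityʳ _
hits-snoc (x ∷ᵛ g) y i = trans (cong ((toℕ x ≡ᵇ i) ∨_) (hits-snoc g y i)) (sym (∨-assoc (toℕ x ≡ᵇ i) _ _))

punchInℕ : ℕ → ℕ → ℕ
punchInℕ zero i = suc i
punchInℕ (suc j) zero = zero
punchInℕ (suc j) (suc i) = suc (punchInℕ j i)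

toℕ-punchIn : {N : ℕ} (J : Fin (suc N)) (y : Fin N) → toℕ (punchIn J y) ≡ punchInℕ (toℕ J) (toℕ y)
toℕ-punchIn fz y = refl
toℕ-punchIn (fs J) fz = refl
toℕ-punchIn (fs J) (fs y) = cong suc (toℕ-punchIn J y)

punchInℕ-≡ᵇ : (j a b : ℕ) → (punchInℕ j a ≡ᵇ punchInℕ j b) ≡ (a ≡ᵇ b)
punchInℕ-≡ᵇ zero a b = refl
punchInℕ-≡ᵇ (suc j) zero zero = refl
punchInℕ-≡ᵇ (suc j) zero (suc b) = refl
punchInℕ-≡ᵇ (suc j) (suc a) zero = refl
punchInℕ-≡ᵇ (suc j) (suc a) (suc b) = punchInℕ-≡ᵇ j a b

punchInℕ-avoids : (j i : ℕ) → (punchInℕ j i ≡ᵇ j) ≡ false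
punchInℕ-avoids zero i = refl
punchInℕ-avoids (suc j) zero = refl
punchInℕ-avoids (suc j) (suc i) = punchInℕ-avoids j i

∀<-punchIn : (r j : ℕ) → j ≤ r → (P : ℕ → Bool) →
  ∀< (suc r) (λ i → (j ≡ᵇ i) ∨ P i) ≡ ∀< r (λ i → P (punchInℕ j i))
∀<-punchIn r zero _ P = refl
∀<-punchIn (suc r) (suc j) (s≤s j≤r) P = cong (P 0 ∧_) (∀<-punchIn r j j≤r (P ∘ suc))

hits-punchIn : {N m : ℕ} (J : Fin (suc (suc N))) (f : Vec (Fin (suc N)) m) (i : ℕ) →
  hits (vmap (punchIn J) f) (punchInℕ (toℕ J) i) ≡ hits f i
hits-punchIn J []ᵛ i = refl
hits-punchIn J (y ∷ᵛ f) i =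
  cong₂ _∨_ (trans (cong (_≡ᵇ punchInℕ (toℕ J) i) (toℕ-punchIn J y)) (punchInℕ-≡ᵇ (toℕ J) (toℕ y) i)) (hits-punchIn J f i)

hits-punchIn-avoids : {N m : ℕ} (J : Fin (suc (suc N))) (g : Vec (Fin (suc N)) m) → hits (vmap (punchIn J) g) (toℕ J) ≡ false
hits-punchIn-avoids J []ᵛ = refl
hits-punchIn-avoids J (y ∷ᵛ g) rewrite toℕ-punchIn J y | punchInℕ-avoids (toℕ J) (toℕ y) = hits-punchIn-avoids J g

∑-vecs-avoiding : (n r' : ℕ) (J : Fin (suc (suc r'))) (h : Vec (Fin (suc (suc r'))) n → ℕ) →
  ∑ (vecs (allFin (suc (suc r'))) n) (λ f → ⟦ not (hits f (toℕ J)) ⟧ * h f)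
  ≡ ∑ (vecs (allFin (suc r')) n) (λ f → h (vmap (punchIn J) f))
∑-vecs-avoiding zero r' J h = cong (_+ 0) (*-identityˡ _)
∑-vecs-avoiding (suc n) r' J h = begin
    ∑ (vecs V₂ (suc n)) (λ f → ⟦ not (hits f (toℕ J)) ⟧ * h f)
  ≡⟨ ∑-vecs-cons V₂ n _ ⟩
    ∑ V₂ (λ y → ∑ (vecs V₂ n) (λ f → ⟦ not ((toℕ y ≡ᵇ toℕ J) ∨ hits f (toℕ J)) ⟧ * h (y ∷ᵛ f)))
  ≡⟨ ∑-cong V₂ (λ y → trans (∑-cong (vecs V₂ n) (λ f → split (toℕ y ≡ᵇ toℕ J) (hits f (toℕ J)) (h (y ∷ᵛ f))))
                      (trans (∑-*ˡ ⟦ not (toℕ y ≡ᵇ toℕ J) ⟧ _ (vecs V₂ n))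
                             (cong (⟦ not (toℕ y ≡ᵇ toℕ J) ⟧ *_) (∑-vecs-avoiding n r' J (λ f → h (y ∷ᵛ f)))))) ⟩
    ∑ V₂ (λ y → ⟦ not (toℕ y ≡ᵇ toℕ J) ⟧ * rest y)
  ≡⟨ ∑-allFin (suc (suc r')) (λ y → ⟦ not (toℕ y ≡ᵇ toℕ J) ⟧ * rest y) ⟩
    ∑Fin (suc (suc r')) (λ y → ⟦ not (toℕ y ≡ᵇ toℕ J) ⟧ * rest y)
  ≡⟨ ∑Fin-avoiding (suc r') J rest ⟩
    ∑Fin (suc r') (rest ∘ punchIn J)
  ≡⟨ sym (∑-allFin (suc r') (rest ∘ punchIn J)) ⟩
    ∑ V₁ (λ y → ∑ (vecs V₁ n) (λ f → h (vmap (punchIn J) (y ∷ᵛ f))))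
  ≡⟨ sym (∑-vecs-cons V₁ n (λ f → h (vmap (punchIn J) f))) ⟩
    ∑ (vecs V₁ (suc n)) (λ f → h (vmap (punchIn J) f))
  ∎
  where
    open ≡-Reasoning
    V₁ = allFin (suc r')
    V₂ = allFin (suc (suc r'))
    rest : Fin (suc (suc r')) → ℕ
    rest y = ∑ (vecs V₁ n) (λ f → h (y ∷ᵛ vmap (punchIn J) f))
    split : ∀ a b x → ⟦ not (a ∨ b) ⟧ * x ≡ ⟦ not a ⟧ * (⟦ not b ⟧ * x)
    split true b x = refl
    split false b x = sym (+-identityʳ _)
    ∑Fin-avoiding : (N : ℕ) (J : Fin (suc N)) (φ : Fin (suc N) → ℕ) →
      ∑Fin (suc N) (λ y → ⟦ not (toℕ y ≡ᵇ toℕ J) ⟧ * φ y) ≡ ∑Fin N (φ ∘ punchIn J)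
    ∑Fin-avoiding N fz φ = ∑Fin-cong N (λ y → +-identityʳ (φ (fs y)))
    ∑Fin-avoiding (suc N) (fs J) φ = cong₂ _+_ (+-identityʳ (φ fz)) (∑Fin-avoiding N J (φ ∘ fs))

-- Callan side: the count factors into a red and a blue part

redCount : ℕ → ℕ → ℕ
redCount n r = ∑ (vecs (allFin (suc r)) n) (λ f → ⟦ surj f ⟧)

-- labellings of the k blue elements with r nonempty ordinary blocks,
-- together with a bar position, of weight m
blueCount : ℕ → ℕ → ℕ → ℕ
blueCount k r m = ∑ (vecs (allFin (suc r)) k) (λ g → ∑ (allFin (suc r)) (λ bar → ⟦ surj g ∧ (weightC {r} {0} []ᵛ g bar ≡ᵇ m) ⟧))

-- the red labelling and the blue data are chosen independently
callanR-factor : (n k m r : ℕ) → CallanR n k m r ≡ redCount n r * blueCount k r m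
callanR-factor n k m r = begin
    CallanR n k m r
  ≡⟨ sum-map-as-∑ _ (vecs (allFin (suc r)) n) ⟩
    ∑ (vecs (allFin (suc r)) n) (λ f → sum (map (λ g → count (λ bar → surj f ∧ surj g ∧ (weightC f g bar ≡ᵇ m)) (allFin (suc r)))
                                                (vecs (allFin (suc r)) k)))
  ≡⟨ ∑-cong (vecs (allFin (suc r)) n) blue ⟩
    ∑ (vecs (allFin (suc r)) n) (λ f → ⟦ surj f ⟧ * blueCount k r m)
  ≡⟨ ∑-*ʳ (blueCount k r m) (λ f → ⟦ surj f ⟧) (vecs (allFin (suc r)) n) ⟩
    redCount n r * blueCount k r m
  ∎
  where
    open ≡-Reasoning
    blue : (f : Vec (Fin (suc r)) n) →
      sum (map (λ g → count (λ bar → surj f ∧ surj g ∧ (weightC f g bar ≡ᵇ m)) (allFin (suc r))) (vecs (allFin (suc r)) k))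
      ≡ ⟦ surj f ⟧ * blueCount k r m
    blue f with surj f
    ... | true = trans (sum-map-as-∑ _ (vecs (allFin (suc r)) k))
                   (trans (∑-cong (vecs (allFin (suc r)) k) (λ g → count-as-∑ _ (allFin (suc r)))) (sym (+-identityʳ _)))
    ... | false = trans (sum-map-as-∑ _ (vecs (allFin (suc r)) k))
                   (∑-zero (vecs (allFin (suc r)) k) (λ g → trans (count-as-∑ (λ bar → false) (allFin (suc r)))
                                                                 (∑-zero (allFin (suc r)) (λ _ → refl))))

-- labellings of n elements which become surjective after putting one more
-- element into block y
firstIn : (n r : ℕ) → Fin (suc r) → ℕ
firstIn n r y = ∑ (vecs (allFin (suc r)) n) (λ f → ⟦ ∀< r (λ i → (toℕ y ≡ᵇ i) ∨ hits f i) ⟧)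

redCount-first : (n r : ℕ) → redCount (suc n) r ≡ ∑Fin (suc r) (firstIn n r)
redCount-first n r =
  trans (∑-vecs-cons (allFin (suc r)) n (λ f → ⟦ surj f ⟧))
        (trans (∑-cong (allFin (suc r)) (λ y → ∑-cong (vecs (allFin (suc r)) n) (λ f → cong ⟦_⟧ (surj-as-∀< (y ∷ᵛ f)))))
               (∑-allFin (suc r) (firstIn n r)))

-- an element put into the extra block R^* does not help
firstIn-extra : (n r : ℕ) → firstIn n r (fromℕ r) ≡ redCount n r
firstIn-extra n r = ∑-cong (vecs (allFin (suc r)) n) (λ f → cong ⟦_⟧ (trans (∀<-cong r (λ i i<r →
  cong (_∨ hits f i) (trans (cong (_≡ᵇ i) (toℕ-fromℕ r)) (>⇒≡ᵇ-false r i i<r)))) (sym (surj-as-∀< f))))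

-- an element put into the ordinary block j: either the others already fill
-- block j (and all blocks), or they avoid j and fill all other blocks
firstIn-ordinary : (n r' : ℕ) (j : Fin (suc r')) → firstIn n (suc r') (inject₁ j) ≡ redCount n (suc r') + redCount n r'
firstIn-ordinary n r' j = begin
    firstIn n r (inject₁ j)
  ≡⟨ ∑-cong V (λ f → split f) ⟩
    ∑ V (λ f → ⟦ surj f ⟧ + ⟦ not (hits f J) ⟧ * ⟦ ∀< r (λ i → (J ≡ᵇ i) ∨ hits f i) ⟧)
  ≡⟨ ∑-+ _ _ V ⟩
    redCount n r + ∑ V (λ f → ⟦ not (hits f J) ⟧ * ⟦ ∀< r (λ i → (J ≡ᵇ i) ∨ hits f i) ⟧)
  ≡⟨ cong (redCount n r +_) (∑-vecs-avoiding n r' (inject₁ j) _) ⟩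
    redCount n r + ∑ (vecs (allFin r) n) (λ f → ⟦ ∀< r (λ i → (J ≡ᵇ i) ∨ hits (vmap (punchIn (inject₁ j)) f) i) ⟧)
  ≡⟨ cong (redCount n r +_) (∑-cong (vecs (allFin r) n) (λ f → cong ⟦_⟧ (relabel f))) ⟩
    redCount n r + redCount n r'
  ∎
  where
    open ≡-Reasoning
    r = suc r'
    V = vecs (allFin (suc r)) n
    J = toℕ (inject₁ j)
    J<r : J < r
    J<r = subst (_< r) (sym (toℕ-inject₁ j)) (toℕ<n j)
    J≤r' : J ≤ r'
    J≤r' = subst (_≤ r') (sym (toℕ-inject₁ j)) (toℕ≤pred[n] j)
    split : (f : Vec (Fin (suc r)) n) →
      ⟦ ∀< r (λ i → (J ≡ᵇ i) ∨ hits f i) ⟧ ≡ ⟦ surj f ⟧ + ⟦ not (hits f J) ⟧ * ⟦ ∀< r (λ i → (J ≡ᵇ i) ∨ hits f i) ⟧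
    split f rewrite surj-as-∀< f with hits f J in eq
    ... | true = trans (cong ⟦_⟧ (∀<-cong r (λ i _ → absorb i))) (sym (+-identityʳ _))
      where
        absorb : ∀ i → ((J ≡ᵇ i) ∨ hits f i) ≡ hits f i
        absorb i with J ≡ᵇ i in e
        ... | false = refl
        ... | true rewrite sym (≡ᵇ-true⇒≡ J i e) = sym eq
    ... | false rewrite ∀<-false r J (hits f) J<r eq = sym (+-identityʳ _)
    relabel : (f : Vec (Fin r) n) → ∀< r (λ i → (J ≡ᵇ i) ∨ hits (vmap (punchIn (inject₁ j)) f) i) ≡ surj f
    relabel f = trans (∀<-punchIn r' J J≤r' (hits (vmap (punchIn (inject₁ j)) f)))
                      (trans (∀<-cong r' (λ i _ → hits-punchIn (inject₁ j) f i)) (sym (surj-as-∀< f)))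

-- removing the first red element gives the recursion of F
redCount≡F : (n r : ℕ) → redCount n r ≡ F n r
redCount≡F zero zero = refl
redCount≡F zero (suc r) = refl
redCount≡F (suc n) zero = trans (redCount-first n 0) (trans (+-identityʳ _) (trans (firstIn-extra n 0) (redCount≡F n 0)))
redCount≡F (suc n) (suc r) = begin
    redCount (suc n) (suc r)
  ≡⟨ redCount-first n (suc r) ⟩
    ∑Fin (suc (suc r)) (firstIn n (suc r))
  ≡⟨ ∑Fin-last (suc r) (firstIn n (suc r)) ⟩
    ∑Fin (suc r) (firstIn n (suc r) ∘ inject₁) + firstIn n (suc r) (fromℕ (suc r))
  ≡⟨ cong₂ _+_ (∑Fin-cong (suc r) (firstIn-ordinary n r)) (firstIn-extra n (suc r)) ⟩
    ∑Fin (suc r) (λ _ → redCount n (suc r) + redCount n r) + redCount n (suc r)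
  ≡⟨ cong (_+ redCount n (suc r)) (∑Fin-const (suc r) _) ⟩
    suc r * (redCount n (suc r) + redCount n r) + redCount n (suc r)
  ≡⟨ cong₂ (λ a b → suc r * (a + b) + a) (redCount≡F n (suc r)) (redCount≡F n r) ⟩
    suc r * (F n (suc r) + F n r) + F n (suc r)
  ≡⟨ regroup r (F n (suc r)) (F n r) ⟩
    F (suc n) (suc r)
  ∎
  where
    open ≡-Reasoning
    regroup : ∀ r a b → suc r * (a + b) + a ≡ suc (suc r) * a + suc r * b
    regroup = solve-∀

-- 0-based position of the first element of block i (k if there is none)
firstIndex : {r k : ℕ} → Vec (Fin (suc r)) k → ℕ → ℕ
firstIndex []ᵛ i = 0
firstIndex (x ∷ᵛ xs) i = if toℕ x ≡ᵇ i then 0 else suc (firstIndex xs i)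

minimaWord : {r k : ℕ} → Vec (Fin (suc r)) k → List ℕ
minimaWord {r} g = applyUpTo (firstIndex g) r

minBlock-fold-shift : {r k k' : ℕ} (x : Fin (suc r)) (xs : Vec (Fin (suc r)) k) (h : Fin k' → Fin k) (i d : ℕ) →
  foldr (λ j acc → if toℕ (lookup (x ∷ᵛ xs) j) ≡ᵇ i then suc (toℕ j) ⊓ acc else acc) (suc d) (tabulate (fs ∘ h))
  ≡ suc (foldr (λ j acc → if toℕ (lookup xs j) ≡ᵇ i then suc (toℕ j) ⊓ acc else acc) d (tabulate h))
minBlock-fold-shift {k' = zero} x xs h i d = refl
minBlock-fold-shift {k' = suc k'} x xs h i d rewrite minBlock-fold-shift x xs (h ∘ fs) i d with toℕ (lookup xs (h fz)) ≡ᵇ i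
... | true = refl
... | false = refl

minBlock≡suc-firstIndex : {r k : ℕ} (g : Vec (Fin (suc r)) k) (i : ℕ) → minBlock g i ≡ suc (firstIndex g i)
minBlock≡suc-firstIndex []ᵛ i = refl
minBlock≡suc-firstIndex {r} {suc k} (x ∷ᵛ xs) i rewrite minBlock-fold-shift x xs (λ j → j) i (suc k) with toℕ x ≡ᵇ i
... | true = refl
... | false = cong suc (minBlock≡suc-firstIndex xs i)

lrMinFrom-0 : (zs : List ℕ) → lrMinFrom 0 zs ≡ 0
lrMinFrom-0 [] = refl
lrMinFrom-0 (z ∷ zs) = lrMinFrom-0 zs

-- the bar (encoded 0) is a left-to-right minimum, and nothing after it is
lrMin-bar : (ys zs : List ℕ) → lrMin (map suc ys ++ 0 ∷ zs) ≡ suc (lrMin ys)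
lrMin-bar [] zs = cong suc (lrMinFrom-0 zs)
lrMin-bar (y ∷ ys) zs = cong suc (from y ys)
  where
    from : (c : ℕ) (ys : List ℕ) → lrMinFrom (suc c) (map suc ys ++ 0 ∷ zs) ≡ suc (lrMinFrom c ys)
    from c [] = cong suc (lrMinFrom-0 zs)
    from c (y ∷ ys) with y <ᵇ c
    ... | true = cong suc (from y ys)
    ... | false = from c ys

weightC≡lrMin-prefix : {r k : ℕ} (g : Vec (Fin (suc r)) k) (bar : Fin (suc r)) →
  weightC {r} {0} []ᵛ g bar ≡ lrMin (take (toℕ bar) (minimaWord g))
weightC≡lrMin-prefix {r} g bar = begin
    lrMin (take p blocks ++ 0 ∷ drop p blocks) ∸ 1
  ≡⟨ cong (λ z → lrMin (take p z ++ 0 ∷ drop p z) ∸ 1) blocks≡ ⟩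
    lrMin (take p (map suc (minimaWord g)) ++ 0 ∷ drop p (map suc (minimaWord g))) ∸ 1
  ≡⟨ cong (λ z → lrMin (z ++ 0 ∷ drop p (map suc (minimaWord g))) ∸ 1) (take-map p (minimaWord g)) ⟩
    lrMin (map suc (take p (minimaWord g)) ++ 0 ∷ drop p (map suc (minimaWord g))) ∸ 1
  ≡⟨ cong (_∸ 1) (lrMin-bar (take p (minimaWord g)) _) ⟩
    lrMin (take p (minimaWord g))
  ∎
  where
    open ≡-Reasoning
    p = toℕ bar
    blocks = map (minBlock g) (upTo r)
    blocks≡ : blocks ≡ map suc (minimaWord g)
    blocks≡ = trans (map-applyUpTo (λ x → x) (minBlock g) r)
                (trans (applyUpTo-cong r (λ i _ → minBlock≡suc-firstIndex g i))
                       (sym (map-applyUpTo (firstIndex g) suc r)))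

-- coefficient of x^m in Σ_{p ≤ L} x^{lrMin (first p letters of w)}
barSum : ℕ → List ℕ → ℕ → ℕ
barSum L w m = ∑< (suc L) (λ p → ⟦ lrMin (take p w) ≡ᵇ m ⟧)

blueCount′ : ℕ → ℕ → ℕ → ℕ
blueCount′ k r m = ∑ (vecs (allFin (suc r)) k) (λ g → ⟦ surj g ⟧ * barSum r (minimaWord g) m)

blueCount≡blueCount′ : (k r m : ℕ) → blueCount k r m ≡ blueCount′ k r m
blueCount≡blueCount′ k r m = ∑-cong (vecs (allFin (suc r)) k) (λ g → begin
    ∑ (allFin (suc r)) (λ bar → ⟦ surj g ∧ (weightC {r} {0} []ᵛ g bar ≡ᵇ m) ⟧)
  ≡⟨ ∑-cong (allFin (suc r)) (λ bar → trans (⟦∧⟧ (surj g) _)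
       (cong (λ z → ⟦ surj g ⟧ * ⟦ z ≡ᵇ m ⟧) (weightC≡lrMin-prefix g bar))) ⟩
    ∑ (allFin (suc r)) (λ bar → ⟦ surj g ⟧ * ⟦ lrMin (take (toℕ bar) (minimaWord g)) ≡ᵇ m ⟧)
  ≡⟨ ∑-*ˡ ⟦ surj g ⟧ _ (allFin (suc r)) ⟩
    ⟦ surj g ⟧ * ∑ (allFin (suc r)) (λ bar → ⟦ lrMin (take (toℕ bar) (minimaWord g)) ≡ᵇ m ⟧)
  ≡⟨ cong (⟦ surj g ⟧ *_) (trans (∑-allFin (suc r) _) (∑Fin-toℕ (suc r) (λ p → ⟦ lrMin (take p (minimaWord g)) ≡ᵇ m ⟧))) ⟩
    ⟦ surj g ⟧ * barSum r (minimaWord g) m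
  ∎)
  where open ≡-Reasoning

insertAt : ℕ → ℕ → List ℕ → List ℕ
insertAt zero v xs = v ∷ xs
insertAt (suc j) v [] = v ∷ []
insertAt (suc j) v (x ∷ xs) = x ∷ insertAt j v xs

-- bar position p in insertAt j _ w corresponds to bar position retract j p in w
retract : ℕ → ℕ → ℕ
retract zero zero = 0
retract zero (suc p) = p
retract (suc j) zero = 0
retract (suc j) (suc p) = suc (retract j p)

HeadBelow : ℕ → List ℕ → Set
HeadBelow M [] = ⊤
HeadBelow M (x ∷ _) = x < M

-- a letter M at least the current minimum c is never a left-to-right minimum
lrMinFrom-insert : (c M j p : ℕ) (w : List ℕ) → c ≤ M →
  lrMinFrom c (take p (insertAt j M w)) ≡ lrMinFrom c (take (retract j p) w)
lrMinFrom-insert c M zero zero w le = refl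
lrMinFrom-insert c M zero (suc p) w le rewrite ≤⇒<ᵇ-false c M le = refl
lrMinFrom-insert c M (suc j) zero [] le = refl
lrMinFrom-insert c M (suc j) (suc p) [] le rewrite ≤⇒<ᵇ-false c M le = empty-prefix p
  where
    empty-prefix : ∀ q → lrMinFrom c (take q []) ≡ 0
    empty-prefix zero = refl
    empty-prefix (suc q) = refl
lrMinFrom-insert c M (suc j) zero (x ∷ w) le = refl
lrMinFrom-insert c M (suc j) (suc p) (x ∷ w) le with x <ᵇ c in e
... | true = cong suc (lrMinFrom-insert x M j p w (<ᵇ-true-≤-trans x c M e le))
... | false = lrMinFrom-insert c M j p w le

lrMin-insert-later : (M j p x : ℕ) (w : List ℕ) → x ≤ M →
  lrMin (take p (insertAt (suc j) M (x ∷ w))) ≡ lrMin (take (retract (suc j) p) (x ∷ w))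
lrMin-insert-later M j zero x w le = refl
lrMin-insert-later M j (suc p) x w le = cong suc (lrMinFrom-insert x M j p w le)

lrMin-insert-front : (M p : ℕ) (w : List ℕ) → HeadBelow M w → lrMin (take (suc p) (M ∷ w)) ≡ suc (lrMin (take p w))
lrMin-insert-front M zero w h = refl
lrMin-insert-front M (suc p) [] h = refl
lrMin-insert-front M (suc p) (x ∷ w) h rewrite <⇒<ᵇ-true x M h = refl

-- retract j hits every position once, and position j twice
∑<-retract : (L j : ℕ) (φ : ℕ → ℕ) → j ≤ L → ∑< (suc (suc L)) (φ ∘ retract j) ≡ ∑< (suc L) φ + φ j
∑<-retract L zero φ _ = +-comm (φ 0) _
∑<-retract (suc L) (suc j) φ (s≤s j≤L) = trans (cong (φ 0 +_) (∑<-retract L j (φ ∘ suc) j≤L)) (sym (+-assoc (φ 0) _ _))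

shift-⟦⟧ : (R : ℕ) (a : ℕ → ℕ) (m : ℕ) → ∑< R (λ p → ⟦ suc (a p) ≡ᵇ m ⟧) ≡ shift (λ m' → ∑< R (λ p → ⟦ a p ≡ᵇ m' ⟧)) m
shift-⟦⟧ R a zero = ∑<-zero R (λ r → refl)
shift-⟦⟧ R a (suc m) = refl

-- Summed over the L + 1 insertion places of a letter M exceeding the first
-- letter of w, the bar sums add up to (L + 1 + x) times the bar sum of w:
-- in front, M adds one minimum to every nonempty prefix; elsewhere it
-- duplicates one bar position.
barSum-insert : (M L : ℕ) (w : List ℕ) → length w ≡ L → HeadBelow M w → (m : ℕ) →
  ∑< (suc L) (λ jj → barSum (suc L) (insertAt jj M w) m) ≡ suc L * barSum L w m + shift (barSum L w) m
barSum-insert M .0 [] refl h zero = refl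
barSum-insert M .0 [] refl h (suc m) = regroup ⟦ 0 ≡ᵇ m ⟧
  where
    regroup : ∀ a → 0 + (a + 0) + 0 ≡ 0 + 0 + 0 * (0 + 0) + (a + 0)
    regroup = solve-∀
barSum-insert M .(length (x ∷ w)) (x ∷ w) refl h m = begin
    inserted 0 + ∑< (suc (length w)) (λ j → inserted (suc j))
  ≡⟨ cong₂ _+_ front (∑<-cong (suc (length w)) later) ⟩
    (⟦ 0 ≡ᵇ m ⟧ + shift (barSum L (x ∷ w)) m) + ∑< (suc (length w)) (λ j → barSum L (x ∷ w) m + φ (suc j))
  ≡⟨ cong ((⟦ 0 ≡ᵇ m ⟧ + shift (barSum L (x ∷ w)) m) +_)
          (trans (∑<-+ (suc (length w)) (λ _ → barSum L (x ∷ w) m) (φ ∘ suc))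
                 (cong (_+ ∑< (suc (length w)) (φ ∘ suc)) (∑<-const (suc (length w)) (barSum L (x ∷ w) m)))) ⟩
    (⟦ 0 ≡ᵇ m ⟧ + shift (barSum L (x ∷ w)) m) + (L * barSum L (x ∷ w) m + ∑< L (φ ∘ suc))
  ≡⟨ regroup ⟦ 0 ≡ᵇ m ⟧ (shift (barSum L (x ∷ w)) m) L (∑< L (φ ∘ suc)) ⟩
    suc L * barSum L (x ∷ w) m + shift (barSum L (x ∷ w)) m
  ∎
  where
    open ≡-Reasoning
    L = length (x ∷ w)
    φ : ℕ → ℕ
    φ p = ⟦ lrMin (take p (x ∷ w)) ≡ᵇ m ⟧
    inserted : ℕ → ℕ
    inserted jj = barSum (suc L) (insertAt jj M (x ∷ w)) m
    front : inserted 0 ≡ ⟦ 0 ≡ᵇ m ⟧ + shift (barSum L (x ∷ w)) m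
    front = cong (⟦ 0 ≡ᵇ m ⟧ +_)
      (trans (∑<-cong (suc L) (λ p _ → cong (λ z → ⟦ z ≡ᵇ m ⟧) (lrMin-insert-front M p (x ∷ w) h)))
             (shift-⟦⟧ (suc L) (λ p → lrMin (take p (x ∷ w))) m))
    later : ∀ j → j < suc (length w) → inserted (suc j) ≡ barSum L (x ∷ w) m + φ (suc j)
    later j (s≤s j≤) = trans (∑<-cong (suc (suc L)) (λ p _ → cong (λ z → ⟦ z ≡ᵇ m ⟧) (lrMin-insert-later M j p x w (<⇒≤ h))))
                             (∑<-retract L (suc j) φ (s≤s j≤))
    regroup : ∀ a s l r → (a + s) + (l * (a + r) + r) ≡ (a + r) + l * (a + r) + s
    regroup = solve-∀

firstIndex-snoc-old : {r k : ℕ} (g : Vec (Fin (suc r)) k) (y : Fin (suc r)) (i : ℕ) →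
  hits g i ≡ true → firstIndex (g ∷ʳ y) i ≡ firstIndex g i
firstIndex-snoc-old (x ∷ᵛ g) y i e with toℕ x ≡ᵇ i
... | true = refl
... | false = cong suc (firstIndex-snoc-old g y i e)

firstIndex-snoc-new : {r k : ℕ} (g : Vec (Fin (suc r)) k) (y : Fin (suc r)) (i : ℕ) →
  hits g i ≡ false → (toℕ y ≡ᵇ i) ≡ true → firstIndex (g ∷ʳ y) i ≡ k
firstIndex-snoc-new []ᵛ y i e1 e2 rewrite e2 = refl
firstIndex-snoc-new (x ∷ᵛ g) y i e1 e2 with toℕ x ≡ᵇ i
firstIndex-snoc-new (x ∷ᵛ g) y i () e2 | true
... | false = cong suc (firstIndex-snoc-new g y i e1 e2)

firstIndex<length : {r k : ℕ} (g : Vec (Fin (suc r)) k) (i : ℕ) → hits g i ≡ true → firstIndex g i < k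
firstIndex<length (x ∷ᵛ g) i e with toℕ x ≡ᵇ i
... | true = s≤s z≤n
... | false = s≤s (firstIndex<length g i e)

firstIndex-punchIn : {N m : ℕ} (J : Fin (suc (suc N))) (g : Vec (Fin (suc N)) m) (i : ℕ) →
  firstIndex (vmap (punchIn J) g) (punchInℕ (toℕ J) i) ≡ firstIndex g i
firstIndex-punchIn J []ᵛ i = refl
firstIndex-punchIn J (y ∷ᵛ g) i rewrite toℕ-punchIn J y | punchInℕ-≡ᵇ (toℕ J) (toℕ y) i with toℕ y ≡ᵇ i
... | true = refl
... | false = cong suc (firstIndex-punchIn J g i)

applyUpTo-insertAt : (f : ℕ → ℕ) (r' jj : ℕ) → jj ≤ r' →
  applyUpTo f (suc r') ≡ insertAt jj (f jj) (applyUpTo (f ∘ punchInℕ jj) r')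
applyUpTo-insertAt f r' zero _ = refl
applyUpTo-insertAt f (suc r') (suc jj) (s≤s le) = cong (f 0 ∷_) (applyUpTo-insertAt (f ∘ suc) r' jj le)

minimaWord-head : {r' k : ℕ} (g : Vec (Fin (suc r')) k) → surj g ≡ true → HeadBelow k (minimaWord g)
minimaWord-head {zero} g e = tt
minimaWord-head {suc r'} g e = firstIndex<length g 0 (surj⇒hits g e 0 (s≤s z≤n))

minimaWord-snoc : {r k : ℕ} (g : Vec (Fin (suc r)) k) (y : Fin (suc r)) → surj g ≡ true →
  minimaWord (g ∷ʳ y) ≡ minimaWord g
minimaWord-snoc {r} g y e = applyUpTo-cong r (λ i i<r → firstIndex-snoc-old g y i (surj⇒hits g e i i<r))

surj-snoc-absorbed : {r k : ℕ} (g : Vec (Fin (suc r)) k) (y : Fin (suc r)) →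
  (∀ i → i < r → (hits g i ∨ (toℕ y ≡ᵇ i)) ≡ hits g i) → surj (g ∷ʳ y) ≡ surj g
surj-snoc-absorbed {r} g y e =
  trans (surj-as-∀< (g ∷ʳ y)) (trans (∀<-cong r (λ i i<r → trans (hits-snoc g y i) (e i i<r))) (sym (surj-as-∀< g)))

blueTerm : {r k : ℕ} → ℕ → Vec (Fin (suc r)) k → Fin (suc r) → ℕ
blueTerm {r} m g y = ⟦ surj (g ∷ʳ y) ⟧ * barSum r (minimaWord (g ∷ʳ y)) m

blueTerm-extra : {r k : ℕ} (m : ℕ) (g : Vec (Fin (suc r)) k) →
  blueTerm m g (fromℕ r) ≡ ⟦ surj g ⟧ * barSum r (minimaWord g) m
blueTerm-extra {r} m g =
  trans (cong (λ b → ⟦ b ⟧ * barSum r (minimaWord (g ∷ʳ fromℕ r)) m) (surj-snoc-absorbed g (fromℕ r) extra))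
        (⟦⟧-guard (surj g) (λ e → cong (λ w → barSum r w m) (minimaWord-snoc g (fromℕ r) e)))
  where
    extra : ∀ i → i < r → (hits g i ∨ (toℕ (fromℕ r) ≡ᵇ i)) ≡ hits g i
    extra i i<r = trans (cong (λ z → hits g i ∨ (z ≡ᵇ i)) (toℕ-fromℕ r)) (trans (cong (hits g i ∨_) (>⇒≡ᵇ-false r i i<r)) (∨-identityʳ _))

-- the last element goes into the ordinary block j: either that block is
-- already nonempty, or it is a new singleton block
blueTerm-ordinary : {r k : ℕ} (m : ℕ) (g : Vec (Fin (suc r)) k) (j : Fin r) →
  blueTerm m g (inject₁ j) ≡ ⟦ surj g ⟧ * barSum r (minimaWord g) m + ⟦ not (hits g (toℕ (inject₁ j))) ⟧ * blueTerm m g (inject₁ j)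
blueTerm-ordinary {r} m g j with hits g (toℕ (inject₁ j)) in eq
... | true = trans (cong (λ b → ⟦ b ⟧ * barSum r (minimaWord (g ∷ʳ inject₁ j)) m) (surj-snoc-absorbed g (inject₁ j) (λ i _ → absorb i)))
               (trans (⟦⟧-guard (surj g) (λ e → cong (λ w → barSum r w m) (minimaWord-snoc g (inject₁ j) e))) (sym (+-identityʳ _)))
  where
    absorb : ∀ i → (hits g i ∨ (toℕ (inject₁ j) ≡ᵇ i)) ≡ hits g i
    absorb i with toℕ (inject₁ j) ≡ᵇ i in e
    ... | false = ∨-identityʳ _
    ... | true rewrite sym (≡ᵇ-true⇒≡ (toℕ (inject₁ j)) i e) | eq = refl
... | false = trans (sym (+-identityʳ _)) (cong (λ b → ⟦ b ⟧ * barSum r (minimaWord g) m + (blueTerm m g (inject₁ j) + 0)) (sym not-surj))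
  where
    J<r : toℕ (inject₁ j) < r
    J<r = subst (_< r) (sym (toℕ-inject₁ j)) (toℕ<n j)
    not-surj : surj g ≡ false
    not-surj = trans (surj-as-∀< g) (∀<-false r (toℕ (inject₁ j)) (hits g) J<r eq)

-- a new singleton block j, the other blocks relabelled by punchIn: its
-- minimum k is inserted into the word at position j
blueTerm-new-block : {r' k : ℕ} (m : ℕ) (g : Vec (Fin (suc r')) k) (j : Fin (suc r')) →
  blueTerm m (vmap (punchIn (inject₁ j)) g) (inject₁ j) ≡ ⟦ surj g ⟧ * barSum (suc r') (insertAt (toℕ j) k (minimaWord g)) m
blueTerm-new-block {r'} {k} m g j =
  trans (cong (λ b → ⟦ b ⟧ * barSum (suc r') (minimaWord g′) m) surj≡)
        (⟦⟧-guard (surj g) (λ e → cong (λ w → barSum (suc r') w m) (word≡ e)))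
  where
    J = inject₁ j
    g′ = vmap (punchIn J) g ∷ʳ J
    jj = toℕ J
    jj≤r' : jj ≤ r'
    jj≤r' = subst (_≤ r') (sym (toℕ-inject₁ j)) (toℕ≤pred[n] j)
    surj≡ : surj g′ ≡ surj g
    surj≡ = trans (surj-as-∀< g′)
      (trans (∀<-cong (suc r') (λ i _ → trans (hits-snoc (vmap (punchIn J) g) J i) (∨-comm (hits (vmap (punchIn J) g) i) (jj ≡ᵇ i))))
        (trans (∀<-punchIn r' jj jj≤r' (hits (vmap (punchIn J) g)))
          (trans (∀<-cong r' (λ i _ → hits-punchIn J g i)) (sym (surj-as-∀< g)))))
    word≡ : surj g ≡ true → minimaWord g′ ≡ insertAt (toℕ j) k (minimaWord g)
    word≡ e = trans (applyUpTo-insertAt (firstIndex g′) r' jj jj≤r')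
      (trans (cong₂ (λ a b → insertAt a b (applyUpTo (firstIndex g′ ∘ punchInℕ jj) r'))
                    (toℕ-inject₁ j) (firstIndex-snoc-new (vmap (punchIn J) g) J jj (hits-punchIn-avoids J g) (≡ᵇ-refl jj)))
        (cong (insertAt (toℕ j) k) (applyUpTo-cong r' (λ i i<r' →
          trans (firstIndex-snoc-old (vmap (punchIn J) g) J (punchInℕ jj i) (trans (hits-punchIn J g i) (surj⇒hits g e i i<r')))
                (firstIndex-punchIn J g i)))))

blueCount′-new-blocks : (k r' m : ℕ) →
  ∑ (vecs (allFin (suc (suc r'))) k) (λ g → ∑Fin (suc r') (λ j → ⟦ not (hits g (toℕ (inject₁ j))) ⟧ * blueTerm m g (inject₁ j)))
  ≡ suc r' * blueCount′ k r' m + shift (blueCount′ k r') m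
blueCount′-new-blocks k r' m = begin
    ∑ V (λ g → ∑Fin r (λ j → ⟦ not (hits g (toℕ (inject₁ j))) ⟧ * blueTerm m g (inject₁ j)))
  ≡⟨ ∑-∑Fin-swap V r (λ g j → ⟦ not (hits g (toℕ (inject₁ j))) ⟧ * blueTerm m g (inject₁ j)) ⟩
    ∑Fin r (λ j → ∑ V (λ g → ⟦ not (hits g (toℕ (inject₁ j))) ⟧ * blueTerm m g (inject₁ j)))
  ≡⟨ ∑Fin-cong r (λ j → trans (∑-vecs-avoiding k r' (inject₁ j) (λ g → blueTerm m g (inject₁ j)))
                               (∑-cong V′ (λ g → blueTerm-new-block m g j))) ⟩
    ∑Fin r (λ j → ∑ V′ (λ g → ⟦ surj g ⟧ * inserted (toℕ j) g))
  ≡⟨ sym (∑-∑Fin-swap V′ r (λ g j → ⟦ surj g ⟧ * inserted (toℕ j) g)) ⟩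
    ∑ V′ (λ g → ∑Fin r (λ j → ⟦ surj g ⟧ * inserted (toℕ j) g))
  ≡⟨ ∑-cong V′ (λ g → trans (∑Fin-*ˡ r ⟦ surj g ⟧ (λ j → inserted (toℕ j) g))
                            (cong (⟦ surj g ⟧ *_) (∑Fin-toℕ r (λ jj → inserted jj g)))) ⟩
    ∑ V′ (λ g → ⟦ surj g ⟧ * ∑< r (λ jj → inserted jj g))
  ≡⟨ ∑-cong V′ (λ g → ⟦⟧-guard (surj g) (λ e →
       barSum-insert k r' (minimaWord g) (length-applyUpTo (firstIndex g) r') (minimaWord-head g e) m)) ⟩
    ∑ V′ (λ g → ⟦ surj g ⟧ * (r * barSum r' (minimaWord g) m + shift (λ m' → barSum r' (minimaWord g) m') m))
  ≡⟨ ∑-cong V′ (λ g → *-distribˡ-+ ⟦ surj g ⟧ _ _) ⟩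
    ∑ V′ (λ g → ⟦ surj g ⟧ * (r * barSum r' (minimaWord g) m) + ⟦ surj g ⟧ * shift (λ m' → barSum r' (minimaWord g) m') m)
  ≡⟨ ∑-+ _ _ V′ ⟩
    ∑ V′ (λ g → ⟦ surj g ⟧ * (r * barSum r' (minimaWord g) m)) + ∑ V′ (λ g → ⟦ surj g ⟧ * shift (λ m' → barSum r' (minimaWord g) m') m)
  ≡⟨ cong₂ _+_ (trans (∑-cong V′ (λ g → reorder ⟦ surj g ⟧ r (barSum r' (minimaWord g) m))) (∑-*ˡ r _ V′))
               (shift-∑ V′ (λ g → ⟦ surj g ⟧) (λ g m' → barSum r' (minimaWord g) m') m) ⟩
    r * blueCount′ k r' m + shift (blueCount′ k r') m
  ∎
  where
    open ≡-Reasoning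
    r = suc r'
    V = vecs (allFin (suc r)) k
    V′ = vecs (allFin (suc r')) k
    inserted : ℕ → Vec (Fin (suc r')) k → ℕ
    inserted jj g = barSum (suc r') (insertAt jj k (minimaWord g)) m
    reorder : ∀ a r s → a * (r * s) ≡ r * (a * s)
    reorder = solve-∀

-- adding the last blue element gives the recursion of G
blueCount′-step : (k r' m : ℕ) →
  blueCount′ (suc k) (suc r') m ≡ suc (suc r') * blueCount′ k (suc r') m + suc r' * blueCount′ k r' m + shift (blueCount′ k r') m
blueCount′-step k r' m = begin
    blueCount′ (suc k) r m
  ≡⟨ ∑-vecs-snoc (allFin (suc r)) k _ ⟩
    ∑ V (λ g → ∑ (allFin (suc r)) (blueTerm m g))
  ≡⟨ ∑-cong V (λ g → trans (∑-allFin (suc r) (blueTerm m g)) (∑Fin-last r (blueTerm m g))) ⟩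
    ∑ V (λ g → ∑Fin r (λ j → blueTerm m g (inject₁ j)) + blueTerm m g (fromℕ r))
  ≡⟨ ∑-cong V (λ g → cong₂ _+_ (∑Fin-cong r (blueTerm-ordinary m g)) (blueTerm-extra m g)) ⟩
    ∑ V (λ g → ∑Fin r (λ j → old g + new g j) + old g)
  ≡⟨ ∑-cong V (λ g → trans (cong (_+ old g) (trans (∑Fin-+ r (λ _ → old g) (new g)) (cong (_+ ∑Fin r (new g)) (∑Fin-const r (old g)))))
                           (regroup₁ (r * old g) (∑Fin r (new g)) (old g))) ⟩
    ∑ V (λ g → (r * old g + old g) + ∑Fin r (new g))
  ≡⟨ trans (∑-+ (λ g → r * old g + old g) (λ g → ∑Fin r (new g)) V)
           (cong (_+ ∑ V (λ g → ∑Fin r (new g))) (trans (∑-+ (λ g → r * old g) old V) (cong (_+ ∑ V old) (∑-*ˡ r old V)))) ⟩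
    (r * blueCount′ k r m + blueCount′ k r m) + ∑ V (λ g → ∑Fin r (new g))
  ≡⟨ cong ((r * blueCount′ k r m + blueCount′ k r m) +_) (blueCount′-new-blocks k r' m) ⟩
    (r * blueCount′ k r m + blueCount′ k r m) + (r * blueCount′ k r' m + shift (blueCount′ k r') m)
  ≡⟨ regroup₂ r' (blueCount′ k r m) (blueCount′ k r' m) (shift (blueCount′ k r') m) ⟩
    suc (suc r') * blueCount′ k (suc r') m + suc r' * blueCount′ k r' m + shift (blueCount′ k r') m
  ∎
  where
    open ≡-Reasoning
    r = suc r'
    V = vecs (allFin (suc r)) k
    old : Vec (Fin (suc r)) k → ℕ
    old g = ⟦ surj g ⟧ * barSum r (minimaWord g) m
    new : Vec (Fin (suc r)) k → Fin r → ℕ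
    new g j = ⟦ not (hits g (toℕ (inject₁ j))) ⟧ * blueTerm m g (inject₁ j)
    regroup₁ : ∀ a b c → a + b + c ≡ (a + c) + b
    regroup₁ = solve-∀
    regroup₂ : ∀ r a b s → (suc r * a + a) + (suc r * b + s) ≡ suc (suc r) * a + suc r * b + s
    regroup₂ = solve-∀

-- hence the blue count is G (the case r = 0 has only the extra block)
blueCount′≡G : (k r m : ℕ) → blueCount′ k r m ≡ G k r m
blueCount′≡G zero zero zero = refl
blueCount′≡G zero zero (suc m) = refl
blueCount′≡G zero (suc r) m = refl
blueCount′≡G (suc k) zero m =
  trans (∑-vecs-snoc (allFin 1) k _) (trans (∑-cong (vecs (allFin 1) k) (λ g → +-identityʳ _)) (blueCount′≡G k 0 m))
blueCount′≡G (suc k) (suc r) m = trans (blueCount′-step k r m)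
  (cong₂ _+_ (cong₂ _+_ (cong (suc (suc r) *_) (blueCount′≡G k (suc r) m)) (cong (suc r *_) (blueCount′≡G k r m)))
             (shift-cong (blueCount′≡G k r) m))

C≡Φ : (n k m : ℕ) → C (suc n) (suc k) m ≡ Φ (suc n) (suc k) m
C≡Φ n k m = trans (sum-map-as-∑ (CallanR (suc n) (suc k) m) (upTo (suc (suc n))))
  (trans (∑-applyUpTo (λ x → x) (suc (suc n)) (CallanR (suc n) (suc k) m))
    (∑<-cong (suc (suc n)) (λ r _ → trans (callanR-factor (suc n) (suc k) m r)
       (cong₂ _*_ (redCount≡F (suc n) r) (trans (blueCount≡blueCount′ (suc k) r m) (blueCount′≡G (suc k) r m))))))

isDown : Cell → Bool
isDown downArrow = true
isDown _ = false

hasLeft : {k : ℕ} → Vec Cell k → Bool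
hasLeft r = any isLeft (toList r)

cellOK′ : {n k : ℕ} → Filling n k → Fin n → Fin k → Cell → Bool
cellOK′ t i j empty = true
cellOK′ {n} {k} t i j leftArrow = ∀Fin k (λ j' → not (toℕ j' <ᵇ toℕ j) ∨ isEmpty (cell t i j'))
cellOK′ {n} {k} t i j downArrow = ∀Fin n (λ i' → not (toℕ i <ᵇ toℕ i') ∨ isEmpty (cell t i' j))

isTableau′ : {n k : ℕ} → Filling n k → Bool
isTableau′ {n} {k} t = ∀Fin n (λ i → ∀Fin k (λ j → cellOK′ t i j (cell t i j)))

counted′ : {n k : ℕ} → Filling n k → Fin n → Fin k → Bool
counted′ {n} {k} t i j = (toℕ i <ᵇ topS t) ∧ isLeft (cell t i j) ∧
  ∀Fin n (λ i' → not (toℕ i' <ᵇ toℕ i) ∨ ∀Fin k (λ j' → not (isLeft (cell t i' j')) ∨ (toℕ j <ᵇ toℕ j')))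

weightOn : {n k : ℕ} → (Fin k → Bool) → Filling n k → ℕ
weightOn {n} {k} P t = ∑Fin n (λ i → ∑Fin k (λ j → ⟦ counted′ t i j ∧ P j ⟧))

tableauCount : ℕ → ℕ → ℕ → ℕ
tableauCount n k m = count (λ t → isTableau t ∧ (weightT t ≡ᵇ m)) (vecs (vecs allCells k) n)

tableauCount-as-∑ : (n k m : ℕ) →
  tableauCount n k m ≡ ∑ (vecs (vecs allCells k) n) (λ t → ⟦ isTableau′ t ∧ (weightOn (λ _ → true) t ≡ᵇ m) ⟧)
tableauCount-as-∑ n k m = trans (count-as-∑ _ (vecs (vecs allCells k) n))
  (∑-cong (vecs (vecs allCells k) n) (λ t → cong₂ (λ a b → ⟦ a ∧ (b ≡ᵇ m) ⟧) (isTableau≡ t) (weight≡ t)))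
  where
    isTableau≡ : {n k : ℕ} (t : Filling n k) → isTableau t ≡ isTableau′ t
    isTableau≡ {n} {k} t = trans (all-allFin n _) (∀Fin-cong n (λ i → trans (all-allFin k _) (∀Fin-cong k (λ j → cellOK≡ i j (cell t i j)))))
      where
        cellOK≡ : ∀ i j c → cellOK t i j c ≡ cellOK′ t i j c
        cellOK≡ i j empty = refl
        cellOK≡ i j leftArrow = all-allFin k _
        cellOK≡ i j downArrow = all-allFin n _
    weight≡ : {n k : ℕ} (t : Filling n k) → weightT t ≡ weightOn (λ _ → true) t
    weight≡ {n} {k} t = trans (sum-map-as-∑ _ (allFin n)) (trans (∑-allFin n _) (∑Fin-cong n (λ i →
       trans (count-allFin k _) (∑Fin-cong k (λ j → cong ⟦_⟧ (trans (counted≡ i j) (sym (∧-identityʳ _))))))))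
      where
        counted≡ : ∀ i j → counted t i j ≡ counted′ t i j
        counted≡ i j = cong (λ z → (toℕ i <ᵇ topS t) ∧ isLeft (cell t i j) ∧ z)
          (trans (all-allFin n _) (∀Fin-cong n (λ i' → cong (not (toℕ i' <ᵇ toℕ i) ∨_) (all-allFin k _))))

-- Tableau side: processing the rows from the top

leftArrowOK : {k : ℕ} → Vec Cell k → Fin k → Cell → Bool
leftArrowOK {k} r j leftArrow = ∀Fin k (λ j' → not (toℕ j' <ᵇ toℕ j) ∨ isEmpty (lookup r j'))
leftArrowOK r j _ = true

rowOK : {k : ℕ} → Vec Cell k → Bool
rowOK {k} r = ∀Fin k (λ j → leftArrowOK r j (lookup r j))

rowEmptyOn : {k : ℕ} → (Fin k → Bool) → Vec Cell k → Bool
rowEmptyOn {k} Z r = ∀Fin k (λ j → not (Z j) ∨ isEmpty (lookup r j))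

colsEmptyOn : {n k : ℕ} → (Fin k → Bool) → Filling n k → Bool
colsEmptyOn {n} {k} Z t = ∀Fin k (λ j → not (Z j) ∨ ∀Fin n (λ i → isEmpty (cell t i j)))

downSet : {k : ℕ} → Vec Cell k → Fin k → Bool
downSet r j = isDown (lookup r j)

leftCountOn : {k : ℕ} → Vec Cell k → (Fin k → Bool) → ℕ
leftCountOn {k} r P = ∑Fin k (λ j → ⟦ isLeft (lookup r j) ∧ P j ⟧)

leftArrowsRightOf : {k : ℕ} → Vec Cell k → Fin k → Bool
leftArrowsRightOf {k} r j = ∀Fin k (λ j' → not (isLeft (lookup r j')) ∨ (toℕ j <ᵇ toℕ j'))

rowWeight : {k : ℕ} → Vec Cell k → (Fin k → Bool) → ℕ
rowWeight r P = if hasLeft r then leftCountOn r P else 0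

-- the columns still counting after the row: none if the row has no left
-- arrow (the top part ends), else those left of all its left arrows
stillCounting : {k : ℕ} → Vec Cell k → (Fin k → Bool) → Fin k → Bool
stillCounting r P = if hasLeft r then (λ j → leftArrowsRightOf r j ∧ P j) else (λ _ → false)

tableauxWith : (n k : ℕ) (Z P : Fin k → Bool) (a m : ℕ) → ℕ
tableauxWith n k Z P a m = ∑ (vecs (vecs allCells k) n) (λ t → ⟦ isTableau′ t ∧ colsEmptyOn Z t ∧ (a + weightOn P t ≡ᵇ m) ⟧)

-- the conditions on the first row: its left arrows, and its down arrows
-- (which empty their columns below)
isTableau′-cons : {n k : ℕ} (r : Vec Cell k) (rs : Filling n k) →
  isTableau′ (r ∷ᵛ rs) ≡ (rowOK r ∧ colsEmptyOn (downSet r) rs) ∧ isTableau′ rs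
isTableau′-cons {n} {k} r rs = cong₂ _∧_ (trans (∀Fin-cong k (λ j → first j (lookup r j))) (∀Fin-∧ k _ _))
                                         (∀Fin-cong n (λ i → ∀Fin-cong k (λ j → rest i j (cell rs i j))))
  where
    first : ∀ j c → cellOK′ (r ∷ᵛ rs) fz j c ≡ leftArrowOK r j c ∧ (not (isDown c) ∨ ∀Fin n (λ i → isEmpty (cell rs i j)))
    first j empty = refl
    first j leftArrow = sym (∧-identityʳ _)
    first j downArrow = refl
    rest : ∀ i j c → cellOK′ (r ∷ᵛ rs) (fs i) j c ≡ cellOK′ rs i j c
    rest i j empty = refl
    rest i j leftArrow = refl
    rest i j downArrow = refl

colsEmptyOn-cons : {n k : ℕ} (Z : Fin k → Bool) (r : Vec Cell k) (rs : Filling n k) →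
  colsEmptyOn Z (r ∷ᵛ rs) ≡ rowEmptyOn Z r ∧ colsEmptyOn Z rs
colsEmptyOn-cons {n} {k} Z r rs = trans (∀Fin-cong k (λ j → ∨-distribˡ-∧ (not (Z j)) _ _)) (∀Fin-∧ k _ _)

colsEmptyOn-∨ : {n k : ℕ} (Z Z' : Fin k → Bool) (t : Filling n k) →
  colsEmptyOn Z t ∧ colsEmptyOn Z' t ≡ colsEmptyOn (λ j → Z j ∨ Z' j) t
colsEmptyOn-∨ {n} {k} Z Z' t = trans (sym (∀Fin-∧ k _ _)) (∀Fin-cong k (λ j → merge (Z j) (Z' j) _))
  where
    merge : ∀ a b x → (not a ∨ x) ∧ (not b ∨ x) ≡ not (a ∨ b) ∨ x
    merge true true x = ∧-idem x
    merge true false x = ∧-identityʳ x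
    merge false b x = refl

weightOn-false : {n k : ℕ} (t : Filling n k) → weightOn (λ _ → false) t ≡ 0
weightOn-false {n} {k} t = ∑Fin-zero n (λ i → ∑Fin-zero k (λ j → cong ⟦_⟧ (∧-zeroʳ _)))

weightOn-cons : {n k : ℕ} (P : Fin k → Bool) (r : Vec Cell k) (rs : Filling n k) →
  weightOn P (r ∷ᵛ rs) ≡ rowWeight r P + weightOn (stillCounting r P) rs
weightOn-cons {n} {k} P r rs with hasLeft r
... | true = cong₂ _+_
      (∑Fin-cong k (λ j → cong (λ z → ⟦ z ∧ P j ⟧) (trans (cong (isLeft (lookup r j) ∧_) (∀Fin-true n (λ _ → refl))) (∧-identityʳ _))))
      (∑Fin-cong n (λ i → ∑Fin-cong k (λ j → cong ⟦_⟧ (∧-pull₅ (toℕ i <ᵇ topS rs) (isLeft (cell rs i j)) (leftArrowsRightOf r j) _ (P j)))))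
... | false = trans (cong₂ _+_ (∑Fin-zero k (λ _ → refl)) (∑Fin-zero n (λ i → ∑Fin-zero k (λ _ → refl)))) (sym (weightOn-false rs))

tableauxWith-firstRow : (n k : ℕ) (Z P : Fin k → Bool) (a m : ℕ) →
  tableauxWith (suc n) k Z P a m
  ≡ ∑ (vecs allCells k) (λ r → ⟦ rowOK r ∧ rowEmptyOn Z r ⟧ * tableauxWith n k (λ j → Z j ∨ downSet r j) (stillCounting r P) (a + rowWeight r P) m)
tableauxWith-firstRow n k Z P a m = trans (∑-vecs-cons (vecs allCells k) n _) (∑-cong (vecs allCells k) (λ r →
    trans (∑-cong (vecs (vecs allCells k) n) (λ rs → split r rs)) (∑-*ˡ ⟦ rowOK r ∧ rowEmptyOn Z r ⟧ _ (vecs (vecs allCells k) n))))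
  where
    split : ∀ r rs → ⟦ isTableau′ (r ∷ᵛ rs) ∧ colsEmptyOn Z (r ∷ᵛ rs) ∧ (a + weightOn P (r ∷ᵛ rs) ≡ᵇ m) ⟧
                   ≡ ⟦ rowOK r ∧ rowEmptyOn Z r ⟧
                     * ⟦ isTableau′ rs ∧ colsEmptyOn (λ j → Z j ∨ downSet r j) rs ∧ (a + rowWeight r P + weightOn (stillCounting r P) rs ≡ᵇ m) ⟧
    split r rs rewrite isTableau′-cons r rs | colsEmptyOn-cons Z r rs | weightOn-cons P r rs
      | sym (+-assoc a (rowWeight r P) (weightOn (stillCounting r P) rs))
      | ∧-regroup₆ (rowOK r) (colsEmptyOn (downSet r) rs) (isTableau′ rs) (rowEmptyOn Z r) (colsEmptyOn Z rs)
                (a + rowWeight r P + weightOn (stillCounting r P) rs ≡ᵇ m)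
      | colsEmptyOn-∨ Z (downSet r) rs = ⟦∧⟧ (rowOK r ∧ rowEmptyOn Z r) _

allEmpty : {n : ℕ} → Vec Cell n → Bool
allEmpty []ᵛ = true
allEmpty (c ∷ᵛ ys) = isEmpty c ∧ allEmpty ys

lookup-snoc-inject : {k : ℕ} (r : Vec Cell k) (y : Cell) (j : Fin k) → lookup (r ∷ʳ y) (inject₁ j) ≡ lookup r j
lookup-snoc-inject (x ∷ᵛ r) y fz = refl
lookup-snoc-inject (x ∷ᵛ r) y (fs j) = lookup-snoc-inject r y j

lookup-snoc-last : {k : ℕ} (r : Vec Cell k) (y : Cell) → lookup (r ∷ʳ y) (fromℕ k) ≡ y
lookup-snoc-last []ᵛ y = refl
lookup-snoc-last (x ∷ᵛ r) y = lookup-snoc-last r y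

inject<ᵇlast : {k : ℕ} (j : Fin k) → (toℕ (inject₁ j) <ᵇ toℕ (fromℕ k)) ≡ true
inject<ᵇlast {k} j rewrite toℕ-inject₁ j | toℕ-fromℕ k = <⇒<ᵇ-true (toℕ j) k (toℕ<n j)

last≮ᵇinject : {k : ℕ} (j : Fin k) → (toℕ (fromℕ k) <ᵇ toℕ (inject₁ j)) ≡ false
last≮ᵇinject {k} j rewrite toℕ-inject₁ j | toℕ-fromℕ k = ≤⇒<ᵇ-false (toℕ j) k (<⇒≤ (toℕ<n j))

last≮ᵇlast : (k : ℕ) → (toℕ (fromℕ k) <ᵇ toℕ (fromℕ k)) ≡ false
last≮ᵇlast k rewrite toℕ-fromℕ k = ≤⇒<ᵇ-false k k ≤-refl

∀Fin-isEmpty : {k : ℕ} (r : Vec Cell k) → ∀Fin k (λ j → isEmpty (lookup r j)) ≡ allEmpty r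
∀Fin-isEmpty []ᵛ = refl
∀Fin-isEmpty (x ∷ᵛ r) = cong (isEmpty x ∧_) (∀Fin-isEmpty r)

hasLeft-as-∃Fin : {k : ℕ} (r : Vec Cell k) → hasLeft r ≡ ∃Fin k (λ j → isLeft (lookup r j))
hasLeft-as-∃Fin []ᵛ = refl
hasLeft-as-∃Fin (x ∷ᵛ r) = cong (isLeft x ∨_) (hasLeft-as-∃Fin r)

rowOK-snoc : {k : ℕ} (r : Vec Cell k) (y : Cell) → rowOK (r ∷ʳ y) ≡ rowOK r ∧ (not (isLeft y) ∨ allEmpty r)
rowOK-snoc {k} r y = trans (∀Fin-last k (λ j → leftArrowOK (r ∷ʳ y) j (lookup (r ∷ʳ y) j)))
  (cong₂ _∧_ (∀Fin-cong k (λ j → trans (cong (leftArrowOK (r ∷ʳ y) (inject₁ j)) (lookup-snoc-inject r y j)) (earlier j (lookup r j))))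
             (trans (cong (leftArrowOK (r ∷ʳ y) (fromℕ k)) (lookup-snoc-last r y)) (last y)))
  where
    earlier : ∀ j c → leftArrowOK (r ∷ʳ y) (inject₁ j) c ≡ leftArrowOK r j c
    earlier j empty = refl
    earlier j downArrow = refl
    earlier j leftArrow = trans (∀Fin-last k (λ j' → not (toℕ j' <ᵇ toℕ (inject₁ j)) ∨ isEmpty (lookup (r ∷ʳ y) j'))) (trans (cong₂ _∧_
        (∀Fin-cong k (λ j' → cong₂ (λ a b → not a ∨ isEmpty b) (cong₂ _<ᵇ_ (toℕ-inject₁ j') (toℕ-inject₁ j)) (lookup-snoc-inject r y j')))
        (cong (λ a → not a ∨ isEmpty (lookup (r ∷ʳ y) (fromℕ k))) (last≮ᵇinject j))) (∧-identityʳ _))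
    last : ∀ y → leftArrowOK (r ∷ʳ y) (fromℕ k) y ≡ not (isLeft y) ∨ allEmpty r
    last empty = refl
    last downArrow = refl
    last leftArrow = trans (∀Fin-last k (λ j' → not (toℕ j' <ᵇ toℕ (fromℕ k)) ∨ isEmpty (lookup (r ∷ʳ leftArrow) j'))) (trans (cong₂ _∧_
        (∀Fin-cong k (λ j' → cong₂ (λ a b → not a ∨ isEmpty b) (inject<ᵇlast j') (lookup-snoc-inject r leftArrow j')))
        (cong (λ a → not a ∨ isEmpty (lookup (r ∷ʳ leftArrow) (fromℕ k))) (last≮ᵇlast k))) (trans (∧-identityʳ _) (∀Fin-isEmpty r)))

rowEmptyOn-snoc : {k : ℕ} (Z : Fin (suc k) → Bool) (r : Vec Cell k) (y : Cell) →
  rowEmptyOn Z (r ∷ʳ y) ≡ rowEmptyOn (Z ∘ inject₁) r ∧ (not (Z (fromℕ k)) ∨ isEmpty y)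
rowEmptyOn-snoc {k} Z r y = trans (∀Fin-last k (λ j → not (Z j) ∨ isEmpty (lookup (r ∷ʳ y) j)))
  (cong₂ _∧_ (∀Fin-cong k (λ j → cong (λ c → not (Z (inject₁ j)) ∨ isEmpty c) (lookup-snoc-inject r y j)))
             (cong (λ c → not (Z (fromℕ k)) ∨ isEmpty c) (lookup-snoc-last r y)))

hasLeft-snoc : {k : ℕ} (r : Vec Cell k) (y : Cell) → hasLeft (r ∷ʳ y) ≡ hasLeft r ∨ isLeft y
hasLeft-snoc []ᵛ y = ∨-identityʳ (isLeft y)
hasLeft-snoc (x ∷ᵛ r) y = trans (cong (isLeft x ∨_) (hasLeft-snoc r y)) (sym (∨-assoc (isLeft x) _ _))

leftCountOn-snoc : {k : ℕ} (r : Vec Cell k) (y : Cell) (P : Fin (suc k) → Bool) →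
  leftCountOn (r ∷ʳ y) P ≡ leftCountOn r (P ∘ inject₁) + ⟦ isLeft y ∧ P (fromℕ k) ⟧
leftCountOn-snoc {k} r y P = trans (∑Fin-last k (λ j → ⟦ isLeft (lookup (r ∷ʳ y) j) ∧ P j ⟧))
  (cong₂ _+_ (∑Fin-cong k (λ j → cong (λ c → ⟦ isLeft c ∧ P (inject₁ j) ⟧) (lookup-snoc-inject r y j)))
             (cong (λ c → ⟦ isLeft c ∧ P (fromℕ k) ⟧) (lookup-snoc-last r y)))

leftArrowsRightOf-snoc-inject : {k : ℕ} (r : Vec Cell k) (y : Cell) (j : Fin k) →
  leftArrowsRightOf (r ∷ʳ y) (inject₁ j) ≡ leftArrowsRightOf r j
leftArrowsRightOf-snoc-inject {k} r y j =
  trans (∀Fin-last k (λ j' → not (isLeft (lookup (r ∷ʳ y) j')) ∨ (toℕ (inject₁ j) <ᵇ toℕ j'))) (trans (cong₂ _∧_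
   (∀Fin-cong k (λ j' → cong₂ (λ c b → not (isLeft c) ∨ b) (lookup-snoc-inject r y j') (cong₂ _<ᵇ_ (toℕ-inject₁ j) (toℕ-inject₁ j'))))
   (trans (cong (not (isLeft (lookup (r ∷ʳ y) (fromℕ k))) ∨_) (inject<ᵇlast j)) (∨-zeroʳ _))) (∧-identityʳ _))

leftArrowsRightOf-snoc-last : {k : ℕ} (r : Vec Cell k) (y : Cell) →
  leftArrowsRightOf (r ∷ʳ y) (fromℕ k) ≡ not (hasLeft r) ∧ not (isLeft y)
leftArrowsRightOf-snoc-last {k} r y = trans (∀Fin-last k (λ j' → not (isLeft (lookup (r ∷ʳ y) j')) ∨ (toℕ (fromℕ k) <ᵇ toℕ j'))) (cong₂ _∧_
   (trans (∀Fin-cong k (λ j' → trans (cong₂ (λ c b → not (isLeft c) ∨ b) (lookup-snoc-inject r y j') (last≮ᵇinject j')) (∨-identityʳ _)))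
          (trans (∀Fin-not k (λ j → isLeft (lookup r j))) (cong not (sym (hasLeft-as-∃Fin r)))))
   (trans (cong₂ (λ c b → not (isLeft c) ∨ b) (lookup-snoc-last r y) (last≮ᵇlast k)) (∨-identityʳ _)))

downSet-snoc-inject : {k : ℕ} (r : Vec Cell k) (y : Cell) (j : Fin k) → downSet (r ∷ʳ y) (inject₁ j) ≡ downSet r j
downSet-snoc-inject r y j = cong isDown (lookup-snoc-inject r y j)

downSet-snoc-last : {k : ℕ} (r : Vec Cell k) (y : Cell) → downSet (r ∷ʳ y) (fromℕ k) ≡ isDown y
downSet-snoc-last r y = cong isDown (lookup-snoc-last r y)

stillCounting-apply : {k : ℕ} (r : Vec Cell k) (P : Fin k → Bool) (j : Fin k) →
  stillCounting r P j ≡ (if hasLeft r then leftArrowsRightOf r j ∧ P j else false)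
stillCounting-apply r P j with hasLeft r
... | true = refl
... | false = refl

module LeftEndedRow (k : ℕ) (P : Fin (suc k) → Bool) where
  row : Vec Cell (suc k)
  row = replicate k empty ∷ʳ leftArrow

  hasLeft-row : hasLeft row ≡ true
  hasLeft-row = trans (hasLeft-snoc (replicate k empty) leftArrow) (∨-zeroʳ _)

  rowWeight-row : rowWeight row P ≡ ⟦ P (fromℕ k) ⟧
  rowWeight-row rewrite hasLeft-row | leftCountOn-snoc (replicate k empty) leftArrow P =
    cong (_+ ⟦ P (fromℕ k) ⟧) (∑Fin-zero k (λ j → cong (λ c → ⟦ isLeft c ∧ P (inject₁ j) ⟧) (lookup-replicate j empty)))

  stillCounting-row-inject : ∀ j → stillCounting row P (inject₁ j) ≡ P (inject₁ j)
  stillCounting-row-inject j rewrite stillCounting-apply row P (inject₁ j) | hasLeft-row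
    | leftArrowsRightOf-snoc-inject (replicate k empty) leftArrow j =
    cong (_∧ P (inject₁ j)) (∀Fin-true k (λ j' → cong (λ c → not (isLeft c) ∨ (toℕ j <ᵇ toℕ j')) (lookup-replicate j' empty)))

  stillCounting-row-last : stillCounting row P (fromℕ k) ≡ false
  stillCounting-row-last rewrite stillCounting-apply row P (fromℕ k) | hasLeft-row
    | leftArrowsRightOf-snoc-last (replicate k empty) leftArrow =
    cong (_∧ P (fromℕ k)) (∧-zeroʳ (not (hasLeft (replicate k empty))))

  downSet-row : ∀ j → downSet row j ≡ false
  downSet-row j = go k j
    where
      go : (k : ℕ) (j : Fin (suc k)) → downSet (replicate k empty ∷ʳ leftArrow) j ≡ false
      go zero fz = refl
      go (suc k) fz = refl
      go (suc k) (fs j) = go k j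

module NonLeftEndedRow {k : ℕ} (r : Vec Cell k) (y : Cell) (not-left : isLeft y ≡ false) (P : Fin (suc k) → Bool) where
  hasLeft-row : hasLeft (r ∷ʳ y) ≡ hasLeft r
  hasLeft-row rewrite hasLeft-snoc r y | not-left = ∨-identityʳ _

  rowWeight-row : rowWeight (r ∷ʳ y) P ≡ rowWeight r (P ∘ inject₁)
  rowWeight-row rewrite hasLeft-row with hasLeft r
  ... | true rewrite leftCountOn-snoc r y P | not-left = +-identityʳ _
  ... | false = refl

  stillCounting-row-inject : ∀ j → stillCounting (r ∷ʳ y) P (inject₁ j) ≡ stillCounting r (P ∘ inject₁) j
  stillCounting-row-inject j rewrite stillCounting-apply (r ∷ʳ y) P (inject₁ j) | stillCounting-apply r (P ∘ inject₁) j
    | hasLeft-row | leftArrowsRightOf-snoc-inject r y j = refl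

  stillCounting-row-last : stillCounting (r ∷ʳ y) P (fromℕ k) ≡ false
  stillCounting-row-last rewrite stillCounting-apply (r ∷ʳ y) P (fromℕ k) | hasLeft-row | leftArrowsRightOf-snoc-last r y with hasLeft r
  ... | true = refl
  ... | false = refl

-- Tableau side: the last column

colValid : {n : ℕ} → Vec Cell n → Bool
colValid []ᵛ = true
colValid (empty ∷ᵛ ys) = colValid ys
colValid (leftArrow ∷ᵛ ys) = colValid ys
colValid (downArrow ∷ᵛ ys) = allEmpty ys

-- number of cells which are not left arrows: the rows surviving the
-- removal of the column (a row ending in a left arrow is empty otherwise)
nonLeft : {n : ℕ} → Vec Cell n → ℕ
nonLeft []ᵛ = 0
nonLeft (leftArrow ∷ᵛ ys) = nonLeft ys
nonLeft (empty ∷ᵛ ys) = suc (nonLeft ys)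
nonLeft (downArrow ∷ᵛ ys) = suc (nonLeft ys)

-- a left arrow in the top cell is the only counted arrow of the column
startsLeft : {n : ℕ} → Vec Cell n → Bool
startsLeft []ᵛ = false
startsLeft (c ∷ᵛ _) = isLeft c

allEmpty⇒colValid : {n : ℕ} (ys : Vec Cell n) → allEmpty ys ≡ true → colValid ys ≡ true
allEmpty⇒colValid []ᵛ e = refl
allEmpty⇒colValid (empty ∷ᵛ ys) e = allEmpty⇒colValid ys e

allEmpty⇒rowOK : {k : ℕ} (r : Vec Cell k) → rowOK r ∧ allEmpty r ≡ allEmpty r
allEmpty⇒rowOK {k} r with allEmpty r in e
... | false = ∧-zeroʳ _
... | true = trans (∧-identityʳ _) (∀Fin-true k (λ j → cong (leftArrowOK r j) (lookup-empty r e j)))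
  where
    lookup-empty : {k : ℕ} (r : Vec Cell k) → allEmpty r ≡ true → ∀ j → lookup r j ≡ empty
    lookup-empty (empty ∷ᵛ r) e fz = refl
    lookup-empty (empty ∷ᵛ r) e (fs j) = lookup-empty r e j

∑-vecs-cells : {n : ℕ} (f : Vec Cell (suc n) → ℕ) → ∑ (vecs allCells (suc n)) f
  ≡ ∑ (vecs allCells n) (λ v → f (empty ∷ᵛ v)) + ∑ (vecs allCells n) (λ v → f (leftArrow ∷ᵛ v))
    + ∑ (vecs allCells n) (λ v → f (downArrow ∷ᵛ v))
∑-vecs-cells {n} f = trans (∑-vecs-cons allCells n f) (trans (cong (λ z → e + (l + z)) (+-identityʳ d)) (sym (+-assoc e l d)))
  where
    e = ∑ (vecs allCells n) (λ v → f (empty ∷ᵛ v))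
    l = ∑ (vecs allCells n) (λ v → f (leftArrow ∷ᵛ v))
    d = ∑ (vecs allCells n) (λ v → f (downArrow ∷ᵛ v))

∑-allEmpty : (n : ℕ) (h : Vec Cell n → ℕ) → ∑ (vecs allCells n) (λ v → ⟦ allEmpty v ⟧ * h v) ≡ h (replicate n empty)
∑-allEmpty zero h = trans (+-identityʳ _) (*-identityˡ _)
∑-allEmpty (suc n) h =
  trans (∑-vecs-cells (λ v → ⟦ allEmpty v ⟧ * h v))
        (trans (cong₂ (λ a b → ∑ (vecs allCells n) (λ v → ⟦ allEmpty v ⟧ * h (empty ∷ᵛ v)) + a + b)
                      (∑-zero (vecs allCells n) (λ _ → refl)) (∑-zero (vecs allCells n) (λ _ → refl)))
               (trans (+-identityʳ _) (trans (+-identityʳ _) (∑-allEmpty n (λ v → h (empty ∷ᵛ v))))))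

factor-left : ∀ z cv ae x → ⟦ not z ⟧ * (⟦ cv ∧ (not (z ∨ false) ∨ ae) ⟧ * x) ≡ ⟦ cv ∧ (not z ∨ false) ⟧ * x
factor-left true cv ae x = sym (cong (λ b → ⟦ b ⟧ * x) (∧-zeroʳ cv))
factor-left false cv ae x = *-identityˡ _

factor-empty : ∀ b z cv ae x → ⟦ b ⟧ * (⟦ cv ∧ (not (z ∨ false) ∨ ae) ⟧ * x) ≡ ⟦ cv ∧ (not z ∨ (true ∧ ae)) ⟧ * (⟦ b ⟧ * x)
factor-empty b z cv ae x = trans (swap ⟦ b ⟧ ⟦ cv ∧ (not (z ∨ false) ∨ ae) ⟧ x)
  (cong (λ z' → ⟦ cv ∧ (not z' ∨ ae) ⟧ * (⟦ b ⟧ * x)) (∨-identityʳ z))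
  where
    swap : ∀ a c x → a * (c * x) ≡ c * (a * x)
    swap = solve-∀

factor-down : ∀ ro z cv ae x → (ae ≡ true → cv ≡ true) →
  ⟦ ro ∧ not z ⟧ * (⟦ cv ∧ (not (z ∨ true) ∨ ae) ⟧ * x) ≡ ⟦ ae ∧ (not z ∨ false) ⟧ * (⟦ ro ⟧ * x)
factor-down ro true cv ae x h rewrite ∧-zeroʳ ro | ∧-zeroʳ ae = refl
factor-down ro false cv ae x h rewrite ∧-identityʳ ro | ∧-identityʳ ae =
  trans (cong (λ b → ⟦ ro ⟧ * (⟦ b ⟧ * x)) (valid cv ae h)) (swap ⟦ ro ⟧ ⟦ ae ⟧ x)
  where
    valid : ∀ cv ae → (ae ≡ true → cv ≡ true) → cv ∧ ae ≡ ae
    valid cv true h = trans (∧-identityʳ cv) (h refl)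
    valid cv false h = ∧-zeroʳ cv
    swap : ∀ a c x → a * (c * x) ≡ c * (a * x)
    swap = solve-∀

tableauxWith-cong : (n k : ℕ) {Z Z' P P' : Fin k → Bool} {a a' : ℕ} (m : ℕ) →
  (∀ j → Z j ≡ Z' j) → (∀ j → P j ≡ P' j) → a ≡ a' → tableauxWith n k Z P a m ≡ tableauxWith n k Z' P' a' m
tableauxWith-cong n k m eZ eP ea = ∑-cong (vecs (vecs allCells k) n) (λ t →
  cong₂ (λ b w → ⟦ isTableau′ t ∧ b ∧ (w ≡ᵇ m) ⟧)
        (∀Fin-cong k (λ j → cong (λ b → not b ∨ _) (eZ j)))
        (cong₂ _+_ ea (∑Fin-cong n (λ i → ∑Fin-cong k (λ j → cong (λ b → ⟦ counted′ t i j ∧ b ⟧) (eP j))))))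

rowEmptyOn-replicate : (k : ℕ) (Z : Fin k → Bool) → rowEmptyOn Z (replicate k empty) ≡ true
rowEmptyOn-replicate k Z = ∀Fin-true k (λ j → trans (cong (λ c → not (Z j) ∨ isEmpty c) (lookup-replicate j empty)) (∨-zeroʳ _))

module LastColumn (k : ℕ) where
  lst : Fin (suc k)
  lst = fromℕ k

  inj : Fin k → Fin (suc k)
  inj = inject₁

  withoutLast : (rows : ℕ) (Z P : Fin (suc k) → Bool) (a m : ℕ) → ℕ
  withoutLast rows Z P a m = tableauxWith rows k (Z ∘ inj) (P ∘ inj) a m

  byLastColumn : (n : ℕ) (Z P : Fin (suc k) → Bool) (a m : ℕ) → ℕ
  byLastColumn n Z P a m = ∑ (vecs allCells n) (λ col →
    ⟦ colValid col ∧ (not (Z lst) ∨ allEmpty col) ⟧ * withoutLast (nonLeft col) Z P (a + ⟦ startsLeft col ∧ P lst ⟧) m)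

  below : (n : ℕ) (Z P : Fin (suc k) → Bool) (a m : ℕ) → Vec Cell (suc k) → ℕ
  below n Z P a m R = byLastColumn n (λ j → Z j ∨ downSet R j) (stillCounting R P) (a + rowWeight R P) m

  rowTerm : (n : ℕ) (Z P : Fin (suc k) → Bool) (a m : ℕ) → Vec Cell (suc k) → ℕ
  rowTerm n Z P a m R = ⟦ rowOK R ∧ rowEmptyOn Z R ⟧ * below n Z P a m R

  -- a first row ending in a left arrow is otherwise empty; it disappears
  -- from the remaining tableau and counts iff the last column does
  rows-ending-left : (n : ℕ) (Z P : Fin (suc k) → Bool) (a m : ℕ) →
    ∑ (vecs allCells k) (λ r → rowTerm n Z P a m (r ∷ʳ leftArrow))
    ≡ ∑ (vecs allCells n) (λ ys → ⟦ colValid ys ∧ (not (Z lst) ∨ false) ⟧ * withoutLast (nonLeft ys) Z P (a + ⟦ true ∧ P lst ⟧) m)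
  rows-ending-left n Z P a m = begin
      ∑ (vecs allCells k) (λ r → rowTerm n Z P a m (r ∷ʳ leftArrow))
    ≡⟨ ∑-cong (vecs allCells k) (λ r → trans (cong (_* below n Z P a m (r ∷ʳ leftArrow)) (row-condition r)) (*-assoc ⟦ allEmpty r ⟧ _ _)) ⟩
      ∑ (vecs allCells k) (λ r → ⟦ allEmpty r ⟧ * (⟦ rowEmptyOn (Z ∘ inj) r ∧ not (Z lst) ⟧ * below n Z P a m (r ∷ʳ leftArrow)))
    ≡⟨ ∑-allEmpty k (λ r → ⟦ rowEmptyOn (Z ∘ inj) r ∧ not (Z lst) ⟧ * below n Z P a m (r ∷ʳ leftArrow)) ⟩
      ⟦ rowEmptyOn (Z ∘ inj) (replicate k empty) ∧ not (Z lst) ⟧ * below n Z P a m row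
    ≡⟨ cong (λ b → ⟦ b ∧ not (Z lst) ⟧ * below n Z P a m row) (rowEmptyOn-replicate k (Z ∘ inj)) ⟩
      ⟦ not (Z lst) ⟧ * below n Z P a m row
    ≡⟨ sym (∑-*ˡ ⟦ not (Z lst) ⟧ _ (vecs allCells n)) ⟩
      ∑ (vecs allCells n) (λ ys → ⟦ not (Z lst) ⟧ * (⟦ colValid ys ∧ (not (Z′ lst) ∨ allEmpty ys) ⟧ * rest ys))
    ≡⟨ ∑-cong (vecs allCells n) (λ ys → trans
          (cong (λ z → ⟦ not (Z lst) ⟧ * (⟦ colValid ys ∧ (not z ∨ allEmpty ys) ⟧ * rest ys)) (cong (Z lst ∨_) (downSet-row lst)))
          (trans (factor-left (Z lst) (colValid ys) (allEmpty ys) _) (cong (⟦ colValid ys ∧ (not (Z lst) ∨ false) ⟧ *_) (rest≡ ys)))) ⟩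
      ∑ (vecs allCells n) (λ ys → ⟦ colValid ys ∧ (not (Z lst) ∨ false) ⟧ * withoutLast (nonLeft ys) Z P (a + ⟦ true ∧ P lst ⟧) m)
    ∎
    where
      open ≡-Reasoning
      open LeftEndedRow k P
      Z′ = λ j → Z j ∨ downSet row j
      rest : Vec Cell n → ℕ
      rest ys = withoutLast (nonLeft ys) Z′ (stillCounting row P) (a + rowWeight row P + ⟦ startsLeft ys ∧ stillCounting row P lst ⟧) m
      row-condition : ∀ r → ⟦ rowOK (r ∷ʳ leftArrow) ∧ rowEmptyOn Z (r ∷ʳ leftArrow) ⟧
                            ≡ ⟦ allEmpty r ⟧ * ⟦ rowEmptyOn (Z ∘ inj) r ∧ not (Z lst) ⟧
      row-condition r rewrite rowOK-snoc r leftArrow | rowEmptyOn-snoc Z r leftArrow | allEmpty⇒rowOK r | ∨-identityʳ (not (Z lst)) =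
        ⟦∧⟧ (allEmpty r) _
      rest≡ : ∀ ys → rest ys ≡ withoutLast (nonLeft ys) Z P (a + ⟦ true ∧ P lst ⟧) m
      rest≡ ys = tableauxWith-cong (nonLeft ys) k m (λ j → trans (cong (Z (inj j) ∨_) (downSet-row (inj j))) (∨-identityʳ _)) stillCounting-row-inject
        (trans (cong₂ (λ c d → a + c + ⟦ startsLeft ys ∧ d ⟧) rowWeight-row stillCounting-row-last)
               (trans (cong (λ d → a + ⟦ P lst ⟧ + ⟦ d ⟧) (∧-zeroʳ (startsLeft ys))) (+-identityʳ _)))

  -- a first row r ∷ʳ y with y not a left arrow survives as the row r
  module NonLeftEnded (n : ℕ) (Z P : Fin (suc k) → Bool) (a m : ℕ) (y : Cell) (not-left : isLeft y ≡ false) where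
    rest : Vec Cell k → Vec Cell n → ℕ
    rest r ys = tableauxWith (nonLeft ys) k (λ j → Z (inj j) ∨ downSet r j) (stillCounting r (P ∘ inj)) (a + 0 + rowWeight r (P ∘ inj)) m

    below≡ : ∀ r → below n Z P a m (r ∷ʳ y) ≡ ∑ (vecs allCells n) (λ ys → ⟦ colValid ys ∧ (not (Z lst ∨ isDown y) ∨ allEmpty ys) ⟧ * rest r ys)
    below≡ r = ∑-cong (vecs allCells n) (λ ys →
      cong₂ (λ z L → ⟦ colValid ys ∧ (not z ∨ allEmpty ys) ⟧ * L) (cong (Z lst ∨_) (downSet-snoc-last r y))
        (tableauxWith-cong (nonLeft ys) k m (λ j → cong (Z (inj j) ∨_) (downSet-snoc-inject r y j)) stillCounting-row-inject
          (trans (cong₂ (λ c d → a + c + ⟦ startsLeft ys ∧ d ⟧) rowWeight-row stillCounting-row-last)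
                 (trans (cong (λ d → a + rowWeight r (P ∘ inj) + ⟦ d ⟧) (∧-zeroʳ (startsLeft ys))) (regroup a (rowWeight r (P ∘ inj)))))))
      where
        open NonLeftEndedRow r y not-left P
        regroup : ∀ a c → a + c + 0 ≡ a + 0 + c
        regroup = solve-∀

    one-more-row : ∀ ys → withoutLast (suc (nonLeft ys)) Z P (a + 0) m ≡ ∑ (vecs allCells k) (λ r → ⟦ rowOK r ∧ rowEmptyOn (Z ∘ inj) r ⟧ * rest r ys)
    one-more-row ys = tableauxWith-firstRow (nonLeft ys) k (Z ∘ inj) (P ∘ inj) (a + 0) m

    exchange : (c : Vec Cell k → Bool) (d : Vec Cell n → Bool) (D : Vec Cell n → Bool) →
      (∀ r ys → ⟦ c r ⟧ * (⟦ d ys ⟧ * rest r ys) ≡ ⟦ D ys ⟧ * (⟦ rowOK r ∧ rowEmptyOn (Z ∘ inj) r ⟧ * rest r ys)) →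
      ∑ (vecs allCells k) (λ r → ⟦ c r ⟧ * ∑ (vecs allCells n) (λ ys → ⟦ d ys ⟧ * rest r ys))
      ≡ ∑ (vecs allCells n) (λ ys → ⟦ D ys ⟧ * withoutLast (suc (nonLeft ys)) Z P (a + 0) m)
    exchange c d D e = begin
        ∑ (vecs allCells k) (λ r → ⟦ c r ⟧ * ∑ (vecs allCells n) (λ ys → ⟦ d ys ⟧ * rest r ys))
      ≡⟨ ∑-cong (vecs allCells k) (λ r → sym (∑-*ˡ ⟦ c r ⟧ _ (vecs allCells n))) ⟩
        ∑ (vecs allCells k) (λ r → ∑ (vecs allCells n) (λ ys → ⟦ c r ⟧ * (⟦ d ys ⟧ * rest r ys)))
      ≡⟨ ∑-swap (λ r ys → ⟦ c r ⟧ * (⟦ d ys ⟧ * rest r ys)) (vecs allCells k) (vecs allCells n) ⟩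
        ∑ (vecs allCells n) (λ ys → ∑ (vecs allCells k) (λ r → ⟦ c r ⟧ * (⟦ d ys ⟧ * rest r ys)))
      ≡⟨ ∑-cong (vecs allCells n) (λ ys → trans (∑-cong (vecs allCells k) (λ r → e r ys))
           (trans (∑-*ˡ ⟦ D ys ⟧ _ (vecs allCells k)) (cong (⟦ D ys ⟧ *_) (sym (one-more-row ys))))) ⟩
        ∑ (vecs allCells n) (λ ys → ⟦ D ys ⟧ * withoutLast (suc (nonLeft ys)) Z P (a + 0) m)
      ∎
      where open ≡-Reasoning

  rows-ending-empty : (n : ℕ) (Z P : Fin (suc k) → Bool) (a m : ℕ) →
    ∑ (vecs allCells k) (λ r → rowTerm n Z P a m (r ∷ʳ empty))
    ≡ ∑ (vecs allCells n) (λ ys → ⟦ colValid ys ∧ (not (Z lst) ∨ (true ∧ allEmpty ys)) ⟧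
                                  * withoutLast (suc (nonLeft ys)) Z P (a + ⟦ false ∧ P lst ⟧) m)
  rows-ending-empty n Z P a m =
    trans (∑-cong (vecs allCells k) (λ r → cong₂ _*_ (row-condition r) (below≡ r)))
          (exchange (λ r → rowOK r ∧ rowEmptyOn (Z ∘ inj) r) (λ ys → colValid ys ∧ (not (Z lst ∨ false) ∨ allEmpty ys))
                    (λ ys → colValid ys ∧ (not (Z lst) ∨ (true ∧ allEmpty ys)))
                    (λ r ys → factor-empty (rowOK r ∧ rowEmptyOn (Z ∘ inj) r) (Z lst) (colValid ys) (allEmpty ys) (rest r ys)))
    where
      open NonLeftEnded n Z P a m empty refl
      row-condition : ∀ r → ⟦ rowOK (r ∷ʳ empty) ∧ rowEmptyOn Z (r ∷ʳ empty) ⟧ ≡ ⟦ rowOK r ∧ rowEmptyOn (Z ∘ inj) r ⟧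
      row-condition r rewrite rowOK-snoc r empty | rowEmptyOn-snoc Z r empty | ∧-identityʳ (rowOK r)
        | ∨-zeroʳ (not (Z lst)) | ∧-identityʳ (rowEmptyOn (Z ∘ inj) r) = refl

  rows-ending-down : (n : ℕ) (Z P : Fin (suc k) → Bool) (a m : ℕ) →
    ∑ (vecs allCells k) (λ r → rowTerm n Z P a m (r ∷ʳ downArrow))
    ≡ ∑ (vecs allCells n) (λ ys → ⟦ allEmpty ys ∧ (not (Z lst) ∨ false) ⟧ * withoutLast (suc (nonLeft ys)) Z P (a + ⟦ false ∧ P lst ⟧) m)
  rows-ending-down n Z P a m =
    trans (∑-cong (vecs allCells k) (λ r → cong₂ _*_ (row-condition r) (below≡ r)))
          (exchange (λ r → (rowOK r ∧ rowEmptyOn (Z ∘ inj) r) ∧ not (Z lst)) (λ ys → colValid ys ∧ (not (Z lst ∨ true) ∨ allEmpty ys))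
                    (λ ys → allEmpty ys ∧ (not (Z lst) ∨ false))
                    (λ r ys → factor-down (rowOK r ∧ rowEmptyOn (Z ∘ inj) r) (Z lst) (colValid ys) (allEmpty ys) (rest r ys) (allEmpty⇒colValid ys)))
    where
      open NonLeftEnded n Z P a m downArrow refl
      row-condition : ∀ r → ⟦ rowOK (r ∷ʳ downArrow) ∧ rowEmptyOn Z (r ∷ʳ downArrow) ⟧ ≡ ⟦ (rowOK r ∧ rowEmptyOn (Z ∘ inj) r) ∧ not (Z lst) ⟧
      row-condition r rewrite rowOK-snoc r downArrow | rowEmptyOn-snoc Z r downArrow | ∧-identityʳ (rowOK r)
        | ∨-identityʳ (not (Z lst)) = sym (cong ⟦_⟧ (∧-assoc (rowOK r) _ _))

  tableauxWith-lastColumn : (n : ℕ) (Z P : Fin (suc k) → Bool) (a m : ℕ) → tableauxWith n (suc k) Z P a m ≡ byLastColumn n Z P a m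
  tableauxWith-lastColumn zero Z P a m rewrite ∀Fin-true (suc k) {λ j → not (Z j) ∨ true} (λ _ → ∨-zeroʳ _)
    | ∀Fin-true k {λ j → not (Z (inj j)) ∨ true} (λ _ → ∨-zeroʳ _) | ∨-zeroʳ (not (Z lst)) =
    trans (regroup ⟦ a + 0 ≡ᵇ m ⟧) (cong (λ z → 1 * (⟦ z ≡ᵇ m ⟧ + 0) + 0) (sym (+-identityʳ (a + 0))))
    where
      regroup : ∀ t → t + 0 ≡ 1 * (t + 0) + 0
      regroup = solve-∀
  tableauxWith-lastColumn (suc n) Z P a m = begin
      tableauxWith (suc n) (suc k) Z P a m
    ≡⟨ tableauxWith-firstRow n (suc k) Z P a m ⟩
      ∑ (vecs allCells (suc k)) (λ R → ⟦ rowOK R ∧ rowEmptyOn Z R ⟧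
                                       * tableauxWith n (suc k) (λ j → Z j ∨ downSet R j) (stillCounting R P) (a + rowWeight R P) m)
    ≡⟨ ∑-cong (vecs allCells (suc k)) (λ R → cong (⟦ rowOK R ∧ rowEmptyOn Z R ⟧ *_)
         (tableauxWith-lastColumn n (λ j → Z j ∨ downSet R j) (stillCounting R P) (a + rowWeight R P) m)) ⟩
      ∑ (vecs allCells (suc k)) (rowTerm n Z P a m)
    ≡⟨ ∑-vecs-snoc allCells k (rowTerm n Z P a m) ⟩
      ∑ (vecs allCells k) (λ r → term r empty + (term r leftArrow + (term r downArrow + 0)))
    ≡⟨ ∑-cong (vecs allCells k) (λ r → regroup (term r empty) (term r leftArrow) (term r downArrow)) ⟩
      ∑ (vecs allCells k) (λ r → term r empty + term r leftArrow + term r downArrow)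
    ≡⟨ trans (∑-+ (λ r → term r empty + term r leftArrow) (λ r → term r downArrow) (vecs allCells k))
             (cong (_+ ∑ (vecs allCells k) (λ r → term r downArrow)) (∑-+ (λ r → term r empty) (λ r → term r leftArrow) (vecs allCells k))) ⟩
      ∑ (vecs allCells k) (λ r → term r empty) + ∑ (vecs allCells k) (λ r → term r leftArrow) + ∑ (vecs allCells k) (λ r → term r downArrow)
    ≡⟨ cong₂ _+_ (cong₂ _+_ (rows-ending-empty n Z P a m) (rows-ending-left n Z P a m)) (rows-ending-down n Z P a m) ⟩
      _
    ≡⟨ sym (∑-vecs-cells {n} (λ col → ⟦ colValid col ∧ (not (Z lst) ∨ allEmpty col) ⟧
                                      * withoutLast (nonLeft col) Z P (a + ⟦ startsLeft col ∧ P lst ⟧) m)) ⟩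
      byLastColumn (suc n) Z P a m
    ∎
    where
      open ≡-Reasoning
      term : Vec Cell k → Cell → ℕ
      term r y = rowTerm n Z P a m (r ∷ʳ y)
      regroup : ∀ a b c → a + (b + (c + 0)) ≡ a + b + c
      regroup = solve-∀

validCols : ℕ → ℕ → ℕ
validCols n r = ∑ (vecs allCells n) (λ col → ⟦ colValid col ⟧ * F (nonLeft col) r)

validColsPlus : ℕ → ℕ → ℕ
validColsPlus n r = ∑ (vecs allCells n) (λ col → ⟦ colValid col ⟧ * F (suc (nonLeft col)) r)

topNotLeftCols : ℕ → ℕ → ℕ
topNotLeftCols n r = ∑ (vecs allCells n) (λ col → ⟦ colValid col ⟧ * (if startsLeft col then 0 else F (nonLeft col) r))

topLeftCols : ℕ → ℕ → ℕ
topLeftCols n r = ∑ (vecs allCells n) (λ col → ⟦ colValid col ⟧ * (if startsLeft col then F (nonLeft col) r else 0))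

nonLeft-replicate : (n : ℕ) → nonLeft (replicate n empty) ≡ n
nonLeft-replicate zero = refl
nonLeft-replicate (suc n) = cong suc (nonLeft-replicate n)

∑-down-top : (n r : ℕ) → ∑ (vecs allCells n) (λ v → ⟦ allEmpty v ⟧ * F (suc (nonLeft v)) r) ≡ F (suc n) r
∑-down-top n r = trans (∑-allEmpty n (λ v → F (suc (nonLeft v)) r)) (cong (λ z → F (suc z) r) (nonLeft-replicate n))

validColsPlus-suc : (n r : ℕ) → validColsPlus n (suc r) ≡ suc (suc r) * validCols n (suc r) + suc r * validCols n r
validColsPlus-suc n r = begin
    validColsPlus n (suc r)
  ≡⟨ ∑-cong (vecs allCells n) (λ col → distribute r ⟦ colValid col ⟧ (F (nonLeft col) (suc r)) (F (nonLeft col) r)) ⟩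
    ∑ (vecs allCells n) (λ col → suc (suc r) * (⟦ colValid col ⟧ * F (nonLeft col) (suc r)) + suc r * (⟦ colValid col ⟧ * F (nonLeft col) r))
  ≡⟨ ∑-+ _ _ (vecs allCells n) ⟩
    ∑ (vecs allCells n) (λ col → suc (suc r) * (⟦ colValid col ⟧ * F (nonLeft col) (suc r)))
      + ∑ (vecs allCells n) (λ col → suc r * (⟦ colValid col ⟧ * F (nonLeft col) r))
  ≡⟨ cong₂ _+_ (∑-*ˡ (suc (suc r)) _ (vecs allCells n)) (∑-*ˡ (suc r) _ (vecs allCells n)) ⟩
    suc (suc r) * validCols n (suc r) + suc r * validCols n r
  ∎
  where
    open ≡-Reasoning
    distribute : ∀ r a b c → a * (suc (suc r) * b + suc r * c) ≡ suc (suc r) * (a * b) + suc r * (a * c)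
    distribute = solve-∀

validCols-suc : (n r : ℕ) → validCols (suc n) r ≡ validColsPlus n r + validCols n r + F (suc n) r
validCols-suc n r = trans (∑-vecs-cells {n} (λ col → ⟦ colValid col ⟧ * F (nonLeft col) r)) (cong (validColsPlus n r + validCols n r +_) (∑-down-top n r))

topNotLeftCols-suc : (n r : ℕ) → topNotLeftCols (suc n) r ≡ validColsPlus n r + 0 + F (suc n) r
topNotLeftCols-suc n r = trans (∑-vecs-cells {n} (λ col → ⟦ colValid col ⟧ * (if startsLeft col then 0 else F (nonLeft col) r)))
  (cong₂ (λ a b → validColsPlus n r + a + b) (∑-zero (vecs allCells n) (λ v → *-zeroʳ ⟦ colValid v ⟧)) (∑-down-top n r))

topLeftCols-suc : (n r : ℕ) → topLeftCols (suc n) r ≡ 0 + validCols n r + 0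
topLeftCols-suc n r = trans (∑-vecs-cells {n} (λ col → ⟦ colValid col ⟧ * (if startsLeft col then F (nonLeft col) r else 0)))
  (cong₂ (λ a b → a + validCols n r + b) (∑-zero (vecs allCells n) (λ v → *-zeroʳ ⟦ colValid v ⟧)) (∑-allEmpty n (λ v → 0)))

validCols≡ : (n r : ℕ) → validCols n r ≡ suc r * F n r + suc (suc r) * F n (suc r)
validCols≡ zero zero = refl
validCols≡ zero (suc r) = sym (trans (cong (_+ suc (suc (suc r)) * 0) (*-zeroʳ (suc (suc r)))) (*-zeroʳ (suc (suc (suc r)))))
validCols≡ (suc n) zero rewrite validCols-suc n 0 | validCols≡ n 0 = regroup (F n 0) (F n 1)
  where
    regroup : ∀ a b → (1 * a + 2 * b) + (1 * a + 2 * b) + a ≡ 1 * a + 2 * (2 * b + 1 * a)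
    regroup = solve-∀
validCols≡ (suc n) (suc r) rewrite validCols-suc n (suc r) | validColsPlus-suc n r | validCols≡ n (suc r) | validCols≡ n r =
  regroup r (F n r) (F n (suc r)) (F n (suc (suc r)))
  where
    regroup : ∀ r a b c → suc (suc r) * (suc (suc r) * b + suc (suc (suc r)) * c) + suc r * (suc r * a + suc (suc r) * b)
                          + (suc (suc r) * b + suc (suc (suc r)) * c) + (suc (suc r) * b + suc r * a)
                        ≡ suc (suc r) * (suc (suc r) * b + suc r * a) + suc (suc (suc r)) * (suc (suc (suc r)) * c + suc (suc r) * b)
    regroup = solve-∀

topLeftCols≡ : (n r : ℕ) → topLeftCols n r ≡ F n (suc r)
topLeftCols≡ zero r = refl
topLeftCols≡ (suc n) zero rewrite topLeftCols-suc n 0 | validCols≡ n 0 = regroup (F n 0) (F n 1)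
  where
    regroup : ∀ a b → 0 + (1 * a + 2 * b) + 0 ≡ 2 * b + 1 * a
    regroup = solve-∀
topLeftCols≡ (suc n) (suc r) rewrite topLeftCols-suc n (suc r) | validCols≡ n (suc r) = regroup r (F n (suc r)) (F n (suc (suc r)))
  where
    regroup : ∀ r b c → 0 + (suc (suc r) * b + suc (suc (suc r)) * c) + 0 ≡ suc (suc (suc r)) * c + suc (suc r) * b
    regroup = solve-∀

topNotLeftCols≡ : (n r : ℕ) → topNotLeftCols n r ≡ suc r * F n r + suc r * F n (suc r)
topNotLeftCols≡ zero zero = refl
topNotLeftCols≡ zero (suc r) = sym (trans (cong (_+ suc (suc r) * 0) (*-zeroʳ (suc (suc r)))) (*-zeroʳ (suc (suc r))))
topNotLeftCols≡ (suc n) zero rewrite topNotLeftCols-suc n 0 | validCols≡ n 0 = regroup (F n 0) (F n 1)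
  where
    regroup : ∀ a b → (1 * a + 2 * b) + 0 + a ≡ 1 * a + 1 * (2 * b + 1 * a)
    regroup = solve-∀
topNotLeftCols≡ (suc n) (suc r) rewrite topNotLeftCols-suc n (suc r) | validColsPlus-suc n r | validCols≡ n (suc r) | validCols≡ n r =
  regroup r (F n r) (F n (suc r)) (F n (suc (suc r)))
  where
    regroup : ∀ r a b c → suc (suc r) * (suc (suc r) * b + suc (suc (suc r)) * c) + suc r * (suc r * a + suc (suc r) * b) + 0
                          + (suc (suc r) * b + suc r * a)
                        ≡ suc (suc r) * (suc (suc r) * b + suc r * a) + suc (suc r) * (suc (suc (suc r)) * c + suc (suc r) * b)
    regroup = solve-∀

leftCells : {n : ℕ} → Vec Cell n → ℕ
leftCells []ᵛ = 0
leftCells (leftArrow ∷ᵛ ys) = suc (leftCells ys)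
leftCells (empty ∷ᵛ ys) = leftCells ys
leftCells (downArrow ∷ᵛ ys) = leftCells ys

nonLeft+leftCells : {n : ℕ} (v : Vec Cell n) → nonLeft v + leftCells v ≡ n
nonLeft+leftCells []ᵛ = refl
nonLeft+leftCells (leftArrow ∷ᵛ ys) = trans (+-suc (nonLeft ys) (leftCells ys)) (cong suc (nonLeft+leftCells ys))
nonLeft+leftCells (empty ∷ᵛ ys) = cong suc (nonLeft+leftCells ys)
nonLeft+leftCells (downArrow ∷ᵛ ys) = cong suc (nonLeft+leftCells ys)

columnTerm : (Q : ℕ → ℕ → ℕ) → {n : ℕ} → Vec Cell n → ℕ → ℕ
columnTerm Q col m = ⟦ colValid col ⟧ * (if startsLeft col then shift (Q (nonLeft col)) m else Q (nonLeft col) m)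

columnTerm-expand : (k : ℕ) (Q : ℕ → ℕ → ℕ) → (∀ j m → Q j m ≡ Φ j k m) → (n m : ℕ) (col : Vec Cell n) →
  columnTerm Q col m
  ≡ ∑< (suc n) (λ r → ⟦ colValid col ⟧ * (if startsLeft col then 0 else F (nonLeft col) r) * G k r m
                    + ⟦ colValid col ⟧ * (if startsLeft col then F (nonLeft col) r else 0) * shift (G k r) m)
columnTerm-expand k Q hyp n m col = trans (cong (⟦ colValid col ⟧ *_) (shift-if (startsLeft col) widen m)) (split (startsLeft col))
  where
    L = nonLeft col
    widen : ∀ m' → Q L m' ≡ ∑< (suc n) (λ r → F L r * G k r m')
    widen m' = trans (hyp L m') (trans
      (sym (∑<-extend (suc L) (leftCells col) (λ r → F L r * G k r m') (λ i → cong (_* G k (suc L + i) m') (F-vanishes L i))))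
      (cong (λ z → ∑< (suc z) (λ r → F L r * G k r m')) (nonLeft+leftCells col)))
    shift-if : (b : Bool) {P P' : ℕ → ℕ} → (∀ m → P m ≡ P' m) → ∀ m →
      (if b then shift P m else P m) ≡ (if b then shift P' m else P' m)
    shift-if false e m = e m
    shift-if true e m = shift-cong e m
    split : (b : Bool) →
      ⟦ colValid col ⟧ * (if b then shift (λ m' → ∑< (suc n) (λ r → F L r * G k r m')) m else ∑< (suc n) (λ r → F L r * G k r m))
      ≡ ∑< (suc n) (λ r → ⟦ colValid col ⟧ * (if b then 0 else F L r) * G k r m + ⟦ colValid col ⟧ * (if b then F L r else 0) * shift (G k r) m)
    split true = trans (cong (⟦ colValid col ⟧ *_) (trans (shift-∑< (suc n) (λ r m' → F L r * G k r m') m)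
                                                          (∑<-cong (suc n) (λ r _ → shift-* r m))))
                 (trans (sym (∑<-*ˡ (suc n) ⟦ colValid col ⟧ (λ r → F L r * shift (G k r) m)))
                        (∑<-cong (suc n) (λ r _ → regroup ⟦ colValid col ⟧ (F L r) (shift (G k r) m) (G k r m))))
      where
        shift-* : ∀ r m → shift (λ m' → F L r * G k r m') m ≡ F L r * shift (G k r) m
        shift-* r zero = sym (*-zeroʳ (F L r))
        shift-* r (suc m) = refl
        regroup : ∀ a f x y → a * (f * x) ≡ a * 0 * y + a * f * x
        regroup = solve-∀
    split false = trans (sym (∑<-*ˡ (suc n) ⟦ colValid col ⟧ (λ r → F L r * G k r m)))
                   (∑<-cong (suc n) (λ r _ → regroup ⟦ colValid col ⟧ (F L r) (G k r m) (shift (G k r) m)))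
      where
        regroup : ∀ a f x y → a * (f * x) ≡ a * f * x + a * 0 * y
        regroup = solve-∀

-- the recursion of G, summed against F, is the step k → k + 1 of Φ
Φ-suc : (n k m : ℕ) →
  ∑< (suc n) (λ r → (suc r * F n r + suc r * F n (suc r)) * G k r m + F n (suc r) * shift (G k r) m) ≡ Φ n (suc k) m
Φ-suc n k m = begin
    ∑< (suc n) (λ r → (suc r * F n r + suc r * F n (suc r)) * G k r m + F n (suc r) * shift (G k r) m)
  ≡⟨ ∑<-cong (suc n) (λ r _ → regroup₁ r (F n r) (F n (suc r)) (G k r m) (shift (G k r) m)) ⟩
    ∑< (suc n) (λ r → suc r * F n r * G k r m + up r)
  ≡⟨ ∑<-+ (suc n) (λ r → suc r * F n r * G k r m) up ⟩
    1 * F n 0 * G k 0 m + ∑< n (λ r → suc (suc r) * F n (suc r) * G k (suc r) m) + ∑< (suc n) up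
  ≡⟨ cong (1 * F n 0 * G k 0 m + ∑< n (λ r → suc (suc r) * F n (suc r) * G k (suc r) m) +_) top-vanishes ⟩
    1 * F n 0 * G k 0 m + ∑< n (λ r → suc (suc r) * F n (suc r) * G k (suc r) m) + ∑< n up
  ≡⟨ regroup₂ (F n 0) (G k 0 m) _ _ ⟩
    F n 0 * G k 0 m + (∑< n (λ r → suc (suc r) * F n (suc r) * G k (suc r) m) + ∑< n up)
  ≡⟨ cong (F n 0 * G k 0 m +_) (sym (∑<-+ n (λ r → suc (suc r) * F n (suc r) * G k (suc r) m) up)) ⟩
    F n 0 * G k 0 m + ∑< n (λ r → suc (suc r) * F n (suc r) * G k (suc r) m + up r)
  ≡⟨ cong (F n 0 * G k 0 m +_) (∑<-cong n (λ r _ → regroup₃ r (F n (suc r)) (G k (suc r) m) (G k r m) (shift (G k r) m))) ⟩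
    Φ n (suc k) m
  ∎
  where
    open ≡-Reasoning
    up : ℕ → ℕ
    up r = F n (suc r) * (suc r * G k r m + shift (G k r) m)
    top-vanishes : ∑< (suc n) up ≡ ∑< n up
    top-vanishes = trans (cong (λ z → ∑< z up) (+-comm 1 n))
                         (∑<-extend n 1 up (λ i → cong (_* (suc (n + i) * G k (n + i) m + shift (G k (n + i)) m)) (F-vanishes n i)))
    regroup₁ : ∀ r a b g s → (suc r * a + suc r * b) * g + b * s ≡ suc r * a * g + b * (suc r * g + s)
    regroup₁ = solve-∀
    regroup₂ : ∀ f g b c → 1 * f * g + b + c ≡ f * g + (b + c)
    regroup₂ = solve-∀
    regroup₃ : ∀ r f x y s → suc (suc r) * f * x + f * (suc r * y + s) ≡ f * (suc (suc r) * x + suc r * y + s)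
    regroup₃ = solve-∀

∑-columnTerm : (k : ℕ) (Q : ℕ → ℕ → ℕ) → (∀ j m → Q j m ≡ Φ j k m) →
  ∀ n m → ∑ (vecs allCells n) (λ col → columnTerm Q col m) ≡ Φ n (suc k) m
∑-columnTerm k Q hyp n m = begin
    ∑ (vecs allCells n) (λ col → columnTerm Q col m)
  ≡⟨ ∑-cong (vecs allCells n) (columnTerm-expand k Q hyp n m) ⟩
    ∑ (vecs allCells n) (λ col → ∑< (suc n) (λ r → a col r * G k r m + b col r * shift (G k r) m))
  ≡⟨ ∑-∑<-swap (vecs allCells n) (suc n) (λ col r → a col r * G k r m + b col r * shift (G k r) m) ⟩
    ∑< (suc n) (λ r → ∑ (vecs allCells n) (λ col → a col r * G k r m + b col r * shift (G k r) m))
  ≡⟨ ∑<-cong (suc n) (λ r _ → trans (∑-+ (λ col → a col r * G k r m) (λ col → b col r * shift (G k r) m) (vecs allCells n))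
                                   (cong₂ _+_ (∑-*ʳ (G k r m) (λ col → a col r) (vecs allCells n))
                                              (∑-*ʳ (shift (G k r) m) (λ col → b col r) (vecs allCells n)))) ⟩
    ∑< (suc n) (λ r → topNotLeftCols n r * G k r m + topLeftCols n r * shift (G k r) m)
  ≡⟨ ∑<-cong (suc n) (λ r _ → cong₂ (λ x y → x * G k r m + y * shift (G k r) m) (topNotLeftCols≡ n r) (topLeftCols≡ n r)) ⟩
    ∑< (suc n) (λ r → (suc r * F n r + suc r * F n (suc r)) * G k r m + F n (suc r) * shift (G k r) m)
  ≡⟨ Φ-suc n k m ⟩
    Φ n (suc k) m
  ∎
  where
    open ≡-Reasoning
    a : Vec Cell n → ℕ → ℕ
    a col r = ⟦ colValid col ⟧ * (if startsLeft col then 0 else F (nonLeft col) r)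
    b : Vec Cell n → ℕ → ℕ
    b col r = ⟦ colValid col ⟧ * (if startsLeft col then F (nonLeft col) r else 0)

tableauxWith-plain : (n k m : ℕ) → tableauxWith n k (λ _ → false) (λ _ → true) 0 m ≡ tableauCount n k m
tableauxWith-plain n k m = trans (∑-cong (vecs (vecs allCells k) n) (λ t →
  cong (λ b → ⟦ isTableau′ t ∧ (b ∧ (weightOn (λ _ → true) t ≡ᵇ m)) ⟧) (∀Fin-true k (λ _ → refl))))
  (sym (tableauCount-as-∑ n k m))

tableauxWith-shifted : (n k m : ℕ) → tableauxWith n k (λ _ → false) (λ _ → true) 1 m ≡ shift (tableauCount n k) m
tableauxWith-shifted n k zero = ∑-zero (vecs (vecs allCells k) n) (λ t →
  cong ⟦_⟧ (trans (cong (λ b → isTableau′ t ∧ (b ∧ false)) (∀Fin-true k (λ _ → refl))) (∧-zeroʳ (isTableau′ t))))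
tableauxWith-shifted n k (suc m) = tableauxWith-plain n k m

tableauCount-lastColumn : (n k m : ℕ) →
  tableauCount n (suc k) m ≡ ∑ (vecs allCells n) (λ col → columnTerm (λ j m' → tableauCount j k m') col m)
tableauCount-lastColumn n k m = begin
    tableauCount n (suc k) m
  ≡⟨ sym (tableauxWith-plain n (suc k) m) ⟩
    tableauxWith n (suc k) (λ _ → false) (λ _ → true) 0 m
  ≡⟨ LastColumn.tableauxWith-lastColumn k n (λ _ → false) (λ _ → true) 0 m ⟩
    LastColumn.byLastColumn k n (λ _ → false) (λ _ → true) 0 m
  ≡⟨ ∑-cong (vecs allCells n) plain ⟩
    ∑ (vecs allCells n) (λ col → columnTerm (λ j m' → tableauCount j k m') col m)
  ∎
  where
    open ≡-Reasoning
    plain : (col : Vec Cell n) →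
      ⟦ colValid col ∧ (not false ∨ allEmpty col) ⟧ * tableauxWith (nonLeft col) k (λ _ → false) (λ _ → true) (0 + ⟦ startsLeft col ∧ true ⟧) m
      ≡ columnTerm (λ j m' → tableauCount j k m') col m
    plain col rewrite ∧-identityʳ (colValid col) | ∧-identityʳ (startsLeft col) with startsLeft col
    ... | true = cong (⟦ colValid col ⟧ *_) (tableauxWith-shifted (nonLeft col) k m)
    ... | false = cong (⟦ colValid col ⟧ *_) (tableauxWith-plain (nonLeft col) k m)

tableauCount-noColumns : (n m : ℕ) → tableauCount n 0 m ≡ one m
tableauCount-noColumns n m = trans (tableauCount-as-∑ n 0 m)
  (trans (∑-cong (vecs (vecs allCells 0) n) (λ t → cong₂ (λ a b → ⟦ a ∧ (b ≡ᵇ m) ⟧) (∀Fin-true n (λ _ → refl)) (∑Fin-zero n (λ _ → refl))))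
         (trans (single n) (zero-weight m)))
  where
    single : (n : ℕ) → ∑ (vecs (vecs allCells 0) n) (λ _ → ⟦ 0 ≡ᵇ m ⟧) ≡ ⟦ 0 ≡ᵇ m ⟧
    single zero = +-identityʳ _
    single (suc n) = trans (∑-vecs-cons (vecs allCells 0) n (λ _ → ⟦ 0 ≡ᵇ m ⟧)) (trans (+-identityʳ _) (single n))
    zero-weight : ∀ m → ⟦ 0 ≡ᵇ m ⟧ ≡ one m
    zero-weight zero = refl
    zero-weight (suc m) = refl

tableauCount≡Φ : (k n m : ℕ) → tableauCount n k m ≡ Φ n k m
tableauCount≡Φ zero n m = trans (tableauCount-noColumns n m)
  (sym (trans (cong₂ _+_ (cong (_* one m) (F-0 n)) (∑<-zero n (λ r → *-zeroʳ (F n (suc r)))))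
              (trans (+-identityʳ _) (*-identityˡ (one m)))))
tableauCount≡Φ (suc k) n m =
  trans (tableauCount-lastColumn n k m) (∑-columnTerm k (λ j m' → tableauCount j k m') (λ j m' → tableauCount≡Φ k j m') n m)

mainTheorem9 : (n k m : ℕ) → T n k m ≡ C n k m
mainTheorem9 zero k m = refl
mainTheorem9 (suc n) zero m = refl
mainTheorem9 (suc n) (suc k) m = trans (tableauCount≡Φ (suc k) (suc n) m) (sym (C≡Φ n k m))
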